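{- For all integers $n,k\ge 0$, \[ D_{2n}^{(-2k-1)}=D_{2k}^{(-2n-1)}. \]
   Context: For $k\in\mathbb{Z}$ let $\mathrm{A}_k(z)=2\sum_{n=0}^\infty \frac{z^{2n+1}}{(2n+1)^k}$ (for $k\le 0$ this is a rational function; regard it as a formal power series). The poly-cosecant numbers $D_n^{(k)}$ are defined by the formal power series identity $\frac{\mathrm{A}_k(\tanh(t/2))}{\sinh t}=\sum_{n\ge0} D_n^{(k)}\frac{t^n}{n!}$. -}

module Defs where

open import Data.Nat as ℕ using (ℕ; zero; suc; _∸_; _!; _≡ᵇ_; _%_)
open import Data.Nat.Properties using (m^n≢0; _!≢0)
open import Data.Integer as ℤ using (ℤ; +_; -[1+_])
open import Data.Rational using (ℚ; 0ℚ; 1ℚ; _+_; _*_; -_; _/_)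
open import Data.Bool using (if_then_else_)

Series : Set
Series = ℕ → ℚ

Σ≤ : ℕ → (ℕ → ℚ) → ℚ
Σ≤ zero    f = f 0
Σ≤ (suc n) f = Σ≤ n f + f (suc n)

oneS : Series
oneS zero    = 1ℚ
oneS (suc _) = 0ℚ

mulS : Series → Series → Series
mulS f g n = Σ≤ n (λ i → f i * g (n ∸ i))

powS : Series → ℕ → Series
powS f zero    = oneS
powS f (suc m) = mulS f (powS f m)

-- Composition a(g(t)); meaningful when g has zero constant term
-- (then g^m contributes only to coefficients of degree ≥ m).
compS : Series → Series → Series
compS a g n = Σ≤ n (λ m → a m * powS g m n)

-- Multiplicative inverse of a series f with f 0 = 1:
-- 1/f = 1/(1 - h) = Σ_m h^m with h = 1 - f.
geomS : Series
geomS _ = 1ℚ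

invS : Series → Series
invS f = compS geomS h
  where
  h : Series
  h zero    = 0ℚ
  h (suc n) = - f (suc n)

-- t ↦ (coefficients of t^(n+1)) : division by t of a series with zero constant term
shiftS : Series → Series
shiftS f n = f (suc n)

isOdd : ℕ → _
isOdd j = (j % 2) ≡ᵇ 1

halfExpCoeff : ℕ → ℚ
halfExpCoeff n = (+ 1 / (2 ℕ.^ n ℕ.* n !)) {{Data.Nat.Properties.m*n≢0 (2 ℕ.^ n) (n !) {{m^n≢0 2 n}} {{n !≢0}}}}

sinhHalf : Series
sinhHalf n = if isOdd n then halfExpCoeff n else 0ℚ

coshHalf : Series
coshHalf n = if isOdd n then 0ℚ else halfExpCoeff n

tanhHalf : Series
tanhHalf = mulS sinhHalf (invS coshHalf)

sinhS : Series
sinhS n = if isOdd n then (+ 1 / (n !)) {{n !≢0}} else 0ℚ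

-- coefficient of z^(2i+1) in A_k(z) = 2 Σ_i z^(2i+1)/(2i+1)^k
aOdd : ℤ → ℕ → ℚ
aOdd (+ m)     i = (+ 2 / (suc (2 ℕ.* i) ℕ.^ m)) {{m^n≢0 (suc (2 ℕ.* i)) m}}
aOdd -[1+ m ]  i = + (2 ℕ.* (suc (2 ℕ.* i) ℕ.^ suc m)) / 1

A : ℤ → Series
A k j = if isOdd j then aOdd k (j ℕ./ 2) else 0ℚ

-- A_k(tanh(t/2)) / sinh t, computed as (A_k(tanh(t/2))/t) · (sinh t / t)⁻¹
cosecSeries : ℤ → Series
cosecSeries k = mulS (shiftS (compS (A k) tanhHalf)) (invS (shiftS sinhS))

D : ℤ → ℕ → ℚ
D k n = (+ (n !) / 1) * cosecSeries k n

-- Let F m = A₋ₘ(tanh(t/2)) / sinh t. Since A₋ₘ₋₁(z) = z A₋ₘ′(z) and sinh t · (tanh(t/2))′ = tanh(t/2),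
-- the chain rule gives sinh t · F (m+1) = sinh t · (sinh t · F m)′, that is F (m+1) = Φ (F m) with
-- Φ f = cosh t · f + sinh t · f′, and F 0 = 1 because A₀(z) = 2z / (1 − z²).
-- Φ sends sinhʲ t to (j+1) cosh t sinhʲ t and cosh t sinhʲ t to (j+1) sinhʲ t + (j+2) sinhʲ⁺² t, so
-- F (2k+1) = Σₗ (2l+1) U k l · cosh t sinh²ˡ t for numbers U k l given by a two-term recursion in k.
-- The Taylor coefficients (2n)! [t²ⁿ] cosh t sinh²ˡ t obey the same recursion in n (read off from the
-- second derivative), so they are U n l, and D₂ₙ^(−2k−1) = Σₗ (2l+1) U k l U n l is symmetric in k and n.
-- Everything happens in the ring of formal power series over ℚ; identities between the hyperbolic series
-- are proved by uniqueness of power-series solutions of f′ = g, g′ = f.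

module Submission where

open import Defs
open import Level using (0ℓ)
open import Data.Bool as Bool using (Bool; true; false; not; if_then_else_)
open import Data.Product using (_×_; _,_; proj₁; proj₂)
open import Data.Sum using (inj₁; inj₂)
open import Data.Maybe using (Maybe; just; nothing)
open import Data.Nat as ℕ using (ℕ; zero; suc; _∸_; _≤_; _<_; z≤n; s≤s; _!; _%_; _≡ᵇ_)
import Data.Nat.Properties as ℕP
import Data.Nat.DivMod as ℕD
open import Data.Integer as ℤ using (+_; -[1+_])
import Data.Integer.Properties as ℤP
open import Data.Rational as ℚ using (ℚ; 0ℚ; 1ℚ; ½; _+_; _*_; -_; _-_; _/_; toℚᵘ)
open import Data.Rational.Properties
  using ( +-*-commutativeRing; _≟_; toℚᵘ-injective; toℚᵘ-fromℚᵘ; toℚᵘ-homo-+; toℚᵘ-homo-*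
        ; +-comm; +-assoc; *-comm; *-assoc; +-identityˡ; +-identityʳ; *-identityˡ; *-identityʳ
        ; *-zeroˡ; *-zeroʳ; *-distribˡ-+; *-distribʳ-+; +-inverseˡ; +-inverseʳ; neg-distribʳ-* )
import Data.Rational.Unnormalised as ℚᵘ
import Data.Rational.Unnormalised.Properties as ℚᵘP
open import Algebra.Bundles using (CommutativeRing)
open import Algebra.Solver.Ring.AlmostCommutativeRing as ACR using (_-Raw-AlmostCommutative⟶_)
import Algebra.Solver.Ring
open import Tactic.RingSolver using (solve-∀)
open import Tactic.RingSolver.Core.AlmostCommutativeRing using (AlmostCommutativeRing; fromCommutativeRing)
open import Relation.Nullary using (yes; no)
open import Relation.Nullary.Decidable using (dec⇒maybe)
open import Relation.Binary.PropositionalEquality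
import Relation.Binary.Reasoning.Setoid as SetoidReasoning

ℚ-ring : AlmostCommutativeRing 0ℓ 0ℓ
ℚ-ring = fromCommutativeRing +-*-commutativeRing (λ x → dec⇒maybe (0ℚ ≟ x))

fromℕ : ℕ → ℚ
fromℕ k = + k / 1

1/ℕ : (d : ℕ) → .{{ℕ.NonZero d}} → ℚ
1/ℕ d = + 1 / d

toℚᵘ-/ : ∀ i d .{{_ : ℕ.NonZero d}} → toℚᵘ (i / d) ℚᵘ.≃ ℚᵘ.mkℚᵘ i (ℕ.pred d)
toℚᵘ-/ i (suc d) = toℚᵘ-fromℚᵘ (ℚᵘ.mkℚᵘ i d)

fromℕ-suc : ∀ k → fromℕ (suc k) ≡ 1ℚ + fromℕ k
fromℕ-suc k = toℚᵘ-injective (ℚᵘP.≃-trans (toℚᵘ-/ (+ suc k) 1) (ℚᵘP.≃-trans (ℚᵘ.*≡* cross)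
  (ℚᵘP.≃-sym (ℚᵘP.≃-trans (toℚᵘ-homo-+ 1ℚ (fromℕ k)) (ℚᵘP.+-cong (toℚᵘ-/ (+ 1) 1) (toℚᵘ-/ (+ k) 1))))))
  where
  cross : (+ 1 ℤ.+ + k) ℤ.* + 1 ≡ (+ 1 ℤ.* + 1 ℤ.+ + k ℤ.* + 1) ℤ.* + 1
  cross = cong (λ z → (+ 1 ℤ.+ z) ℤ.* + 1) (sym (ℤP.*-identityʳ (+ k)))

fromℕ-+ : ∀ a b → fromℕ (a ℕ.+ b) ≡ fromℕ a + fromℕ b
fromℕ-+ zero    b = sym (+-identityˡ (fromℕ b))
fromℕ-+ (suc a) b = begin
  fromℕ (suc (a ℕ.+ b))        ≡⟨ fromℕ-suc (a ℕ.+ b) ⟩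
  1ℚ + fromℕ (a ℕ.+ b)         ≡⟨ cong (λ t → 1ℚ + t) (fromℕ-+ a b) ⟩
  1ℚ + (fromℕ a + fromℕ b)     ≡⟨ sym (+-assoc 1ℚ (fromℕ a) (fromℕ b)) ⟩
  (1ℚ + fromℕ a) + fromℕ b     ≡⟨ cong (_+ fromℕ b) (sym (fromℕ-suc a)) ⟩
  fromℕ (suc a) + fromℕ b      ∎
  where open ≡-Reasoning

fromℕ-* : ∀ a b → fromℕ (a ℕ.* b) ≡ fromℕ a * fromℕ b
fromℕ-* zero    b = sym (*-zeroˡ (fromℕ b))
fromℕ-* (suc a) b = begin
  fromℕ (b ℕ.+ a ℕ.* b)        ≡⟨ fromℕ-+ b (a ℕ.* b) ⟩
  fromℕ b + fromℕ (a ℕ.* b)    ≡⟨ cong (λ t → fromℕ b + t) (fromℕ-* a b) ⟩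
  fromℕ b + fromℕ a * fromℕ b  ≡⟨ distrib (fromℕ a) (fromℕ b) ⟩
  (1ℚ + fromℕ a) * fromℕ b     ≡⟨ cong (_* fromℕ b) (sym (fromℕ-suc a)) ⟩
  fromℕ (suc a) * fromℕ b      ∎
  where
  open ≡-Reasoning
  distrib : ∀ x y → y + x * y ≡ (1ℚ + x) * y
  distrib = solve-∀ ℚ-ring

fromℕ*1/ℕ : ∀ d .{{_ : ℕ.NonZero d}} → fromℕ d * 1/ℕ d ≡ 1ℚ
fromℕ*1/ℕ (suc d) = toℚᵘ-injective (ℚᵘP.≃-trans (toℚᵘ-homo-* (fromℕ (suc d)) (1/ℕ (suc d)))
  (ℚᵘP.≃-trans (ℚᵘP.*-cong (toℚᵘ-/ (+ suc d) 1) (toℚᵘ-/ (+ 1) (suc d))) (ℚᵘ.*≡* cross)))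
  where
  cross : (+ suc d ℤ.* + 1) ℤ.* + 1 ≡ + 1 ℤ.* + suc (d ℕ.+ 0)
  cross = trans (ℤP.*-identityʳ _) (trans (ℤP.*-identityʳ _)
    (sym (trans (ℤP.*-identityˡ _) (cong (λ m → + suc m) (ℕP.+-identityʳ d)))))

1/ℕ-* : ∀ a b .{{_ : ℕ.NonZero a}} .{{_ : ℕ.NonZero b}} →
        1/ℕ (a ℕ.* b) {{ℕP.m*n≢0 a b}} ≡ 1/ℕ a * 1/ℕ b
1/ℕ-* (suc a) (suc b) = toℚᵘ-injective (ℚᵘP.≃-trans (toℚᵘ-/ (+ 1) (suc a ℕ.* suc b))
  (ℚᵘP.≃-sym (ℚᵘP.≃-trans (toℚᵘ-homo-* (1/ℕ (suc a)) (1/ℕ (suc b)))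
    (ℚᵘP.*-cong (toℚᵘ-/ (+ 1) (suc a)) (toℚᵘ-/ (+ 1) (suc b))))))

fromℕ-suc-cancelˡ : ∀ n {x y} → fromℕ (suc n) * x ≡ fromℕ (suc n) * y → x ≡ y
fromℕ-suc-cancelˡ n {x} {y} e = begin
  x                     ≡⟨ sym (*-identityˡ x) ⟩
  1ℚ * x                ≡⟨ cong (_* x) (sym inv) ⟩
  (r * d) * x           ≡⟨ *-assoc r d x ⟩
  r * (d * x)           ≡⟨ cong (r *_) e ⟩
  r * (d * y)           ≡⟨ sym (*-assoc r d y) ⟩
  (r * d) * y           ≡⟨ cong (_* y) inv ⟩
  1ℚ * y                ≡⟨ *-identityˡ y ⟩
  y                     ∎
  where
  open ≡-Reasoning
  d = fromℕ (suc n)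
  r = 1/ℕ (suc n)
  inv : r * d ≡ 1ℚ
  inv = trans (*-comm r d) (fromℕ*1/ℕ (suc n))

-- Finite sums

Σ≤-cong-≤ : ∀ n {f g : ℕ → ℚ} → (∀ i → i ≤ n → f i ≡ g i) → Σ≤ n f ≡ Σ≤ n g
Σ≤-cong-≤ zero    e = e 0 z≤n
Σ≤-cong-≤ (suc n) e = cong₂ _+_ (Σ≤-cong-≤ n (λ i i≤n → e i (ℕP.m≤n⇒m≤1+n i≤n))) (e (suc n) ℕP.≤-refl)

Σ≤-cong : ∀ n {f g : ℕ → ℚ} → (∀ i → f i ≡ g i) → Σ≤ n f ≡ Σ≤ n g
Σ≤-cong n e = Σ≤-cong-≤ n (λ i _ → e i)

Σ≤-zero : ∀ n {f : ℕ → ℚ} → (∀ i → i ≤ n → f i ≡ 0ℚ) → Σ≤ n f ≡ 0ℚ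
Σ≤-zero zero    e = e 0 z≤n
Σ≤-zero (suc n) e = trans (cong₂ _+_ (Σ≤-zero n (λ i i≤n → e i (ℕP.m≤n⇒m≤1+n i≤n))) (e (suc n) ℕP.≤-refl))
                          (+-identityˡ 0ℚ)

Σ≤-+ : ∀ n (f g : ℕ → ℚ) → Σ≤ n (λ i → f i + g i) ≡ Σ≤ n f + Σ≤ n g
Σ≤-+ zero    f g = refl
Σ≤-+ (suc n) f g = trans (cong (_+ (f (suc n) + g (suc n))) (Σ≤-+ n f g))
                         (interchange (Σ≤ n f) (Σ≤ n g) (f (suc n)) (g (suc n)))
  where
  interchange : ∀ a b c d → (a + b) + (c + d) ≡ (a + c) + (b + d)
  interchange = solve-∀ ℚ-ring

Σ≤-*ˡ : ∀ n c (f : ℕ → ℚ) → c * Σ≤ n f ≡ Σ≤ n (λ i → c * f i)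
Σ≤-*ˡ zero    c f = refl
Σ≤-*ˡ (suc n) c f = trans (*-distribˡ-+ c _ _) (cong (_+ (c * f (suc n))) (Σ≤-*ˡ n c f))

Σ≤-*ʳ : ∀ n c (f : ℕ → ℚ) → Σ≤ n f * c ≡ Σ≤ n (λ i → f i * c)
Σ≤-*ʳ n c f = trans (*-comm _ c) (trans (Σ≤-*ˡ n c f) (Σ≤-cong n (λ i → *-comm c (f i))))

Σ≤-head : ∀ n (f : ℕ → ℚ) → Σ≤ (suc n) f ≡ f 0 + Σ≤ n (λ i → f (suc i))
Σ≤-head zero    f = refl
Σ≤-head (suc n) f = trans (cong (_+ f (suc (suc n))) (Σ≤-head n f))
                          (+-assoc (f 0) (Σ≤ n (λ i → f (suc i))) (f (suc (suc n))))

Σ≤-reverse : ∀ n (f : ℕ → ℚ) → Σ≤ n f ≡ Σ≤ n (λ i → f (n ∸ i))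
Σ≤-reverse zero    f = refl
Σ≤-reverse (suc n) f = begin
  Σ≤ (suc n) f                                   ≡⟨ Σ≤-head n f ⟩
  f 0 + Σ≤ n (λ i → f (suc i))                   ≡⟨ cong (λ t → f 0 + t) (Σ≤-reverse n (λ i → f (suc i))) ⟩
  f 0 + Σ≤ n (λ i → f (suc (n ∸ i)))             ≡⟨ +-comm (f 0) _ ⟩
  Σ≤ n (λ i → f (suc (n ∸ i))) + f 0             ≡⟨ cong₂ _+_ (Σ≤-cong-≤ n (λ i i≤n → cong f (sym (ℕP.+-∸-assoc 1 i≤n))))
                                                               (cong f (sym (ℕP.n∸n≡0 n))) ⟩
  Σ≤ n (λ i → f (suc n ∸ i)) + f (n ∸ n)         ∎
  where open ≡-Reasoning

Σ≤-comm : ∀ n m (F : ℕ → ℕ → ℚ) → Σ≤ n (λ i → Σ≤ m (F i)) ≡ Σ≤ m (λ j → Σ≤ n (λ i → F i j))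
Σ≤-comm zero    m F = refl
Σ≤-comm (suc n) m F = trans (cong (_+ Σ≤ m (F (suc n))) (Σ≤-comm n m F)) (sym (Σ≤-+ m _ _))

Σ≤-triangle : ∀ n (F : ℕ → ℕ → ℚ) →
              Σ≤ n (λ i → Σ≤ i (F i)) ≡ Σ≤ n (λ j → Σ≤ (n ∸ j) (λ k → F (j ℕ.+ k) j))
Σ≤-triangle zero    F = refl
Σ≤-triangle (suc n) F = begin
  Σ≤ n (λ i → Σ≤ i (F i)) + (Σ≤ n (F (suc n)) + F (suc n) (suc n))
    ≡⟨ cong₂ (λ a b → a + (Σ≤ n (F (suc n)) + b)) (Σ≤-triangle n F) (sym diagonal) ⟩
  R + (Σ≤ n (F (suc n)) + L)
    ≡⟨ sym (+-assoc R _ L) ⟩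
  (R + Σ≤ n (F (suc n))) + L
    ≡⟨ cong (_+ L) (sym (Σ≤-+ n _ _)) ⟩
  Σ≤ n (λ j → Σ≤ (n ∸ j) (λ k → F (j ℕ.+ k) j) + F (suc n) j) + L
    ≡⟨ cong (_+ L) (Σ≤-cong-≤ n column) ⟩
  Σ≤ n (λ j → Σ≤ (suc n ∸ j) (λ k → F (j ℕ.+ k) j)) + L
    ∎
  where
  open ≡-Reasoning
  R = Σ≤ n (λ j → Σ≤ (n ∸ j) (λ k → F (j ℕ.+ k) j))
  L = Σ≤ (suc n ∸ suc n) (λ k → F (suc n ℕ.+ k) (suc n))
  diagonal : L ≡ F (suc n) (suc n)
  diagonal rewrite ℕP.n∸n≡0 n | ℕP.+-identityʳ n = refl
  column : ∀ j → j ≤ n → Σ≤ (n ∸ j) (λ k → F (j ℕ.+ k) j) + F (suc n) j ≡ Σ≤ (suc n ∸ j) (λ k → F (j ℕ.+ k) j)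
  column j j≤n rewrite ℕP.+-∸-assoc 1 j≤n =
    cong (λ t → Σ≤ (n ∸ j) (λ k → F (j ℕ.+ k) j) + F t j)
         (sym (trans (ℕP.+-suc j (n ∸ j)) (cong suc (ℕP.m+[n∸m]≡n j≤n))))

Σ≤-extend : ∀ {m} n (f : ℕ → ℚ) → m ≤ n → (∀ i → m < i → i ≤ n → f i ≡ 0ℚ) → Σ≤ m f ≡ Σ≤ n f
Σ≤-extend zero    f z≤n vanish = refl
Σ≤-extend {m} (suc n) f m≤1+n vanish with ℕP.m≤n⇒m<n∨m≡n m≤1+n
... | inj₂ refl        = refl
... | inj₁ (s≤s m≤n) = begin
  Σ≤ m f              ≡⟨ Σ≤-extend n f m≤n (λ i m<i i≤n → vanish i m<i (ℕP.m≤n⇒m≤1+n i≤n)) ⟩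
  Σ≤ n f              ≡⟨ sym (+-identityʳ _) ⟩
  Σ≤ n f + 0ℚ         ≡⟨ cong (λ t → Σ≤ n f + t) (sym (vanish (suc n) (s≤s m≤n) ℕP.≤-refl)) ⟩
  Σ≤ n f + f (suc n)  ∎
  where open ≡-Reasoning

Σ≤-telescope : ∀ n (f : ℕ → ℚ) → Σ≤ n (λ i → f i - f (suc i)) ≡ f 0 - f (suc n)
Σ≤-telescope zero    f = refl
Σ≤-telescope (suc n) f = trans (cong (_+ (f (suc n) - f (suc (suc n)))) (Σ≤-telescope n f))
                               (collapse (f 0) (f (suc n)) (f (suc (suc n))))
  where
  collapse : ∀ a b c → (a - b) + (b - c) ≡ a - c
  collapse = solve-∀ ℚ-ring

-- The ring of formal power series

infix  4 _≈_
infixl 6 _⊕_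
infixl 7 _⊛_

_≈_ : Series → Series → Set
f ≈ g = ∀ n → f n ≡ g n

≈-refl : ∀ {f} → f ≈ f
≈-refl _ = refl

≈-sym : ∀ {f g} → f ≈ g → g ≈ f
≈-sym e n = sym (e n)

≈-trans : ∀ {f g h} → f ≈ g → g ≈ h → f ≈ h
≈-trans e₁ e₂ n = trans (e₁ n) (e₂ n)

_⊕_ : Series → Series → Series
(f ⊕ g) n = f n + g n

negS : Series → Series
negS f n = - f n

zeroS : Series
zeroS _ = 0ℚ

constS : ℚ → Series
constS c zero    = c
constS c (suc _) = 0ℚ

_⊛_ : Series → Series → Series
_⊛_ = mulS

⊕-cong : ∀ {f f′ g g′} → f ≈ f′ → g ≈ g′ → f ⊕ g ≈ f′ ⊕ g′
⊕-cong e₁ e₂ n = cong₂ _+_ (e₁ n) (e₂ n)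

⊕-congˡ : ∀ f {g h} → g ≈ h → f ⊕ g ≈ f ⊕ h
⊕-congˡ f = ⊕-cong (≈-refl {f})

⊕-congʳ : ∀ f {g h} → g ≈ h → g ⊕ f ≈ h ⊕ f
⊕-congʳ f e = ⊕-cong e (≈-refl {f})

⊛-cong : ∀ {f f′ g g′} → f ≈ f′ → g ≈ g′ → f ⊛ g ≈ f′ ⊛ g′
⊛-cong e₁ e₂ n = Σ≤-cong n (λ i → cong₂ _*_ (e₁ i) (e₂ (n ∸ i)))

⊛-congˡ : ∀ f {g h} → g ≈ h → f ⊛ g ≈ f ⊛ h
⊛-congˡ f = ⊛-cong (≈-refl {f})

⊛-congʳ : ∀ f {g h} → g ≈ h → g ⊛ f ≈ h ⊛ f
⊛-congʳ f e = ⊛-cong e (≈-refl {f})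

⊛-comm : ∀ f g → f ⊛ g ≈ g ⊛ f
⊛-comm f g n = trans (Σ≤-reverse n _) (Σ≤-cong-≤ n (λ i i≤n →
  trans (cong (λ t → f (n ∸ i) * g t) (ℕP.m∸[m∸n]≡n i≤n)) (*-comm (f (n ∸ i)) (g i))))

⊛-assoc : ∀ f g h → (f ⊛ g) ⊛ h ≈ f ⊛ (g ⊛ h)
⊛-assoc f g h n = begin
  Σ≤ n (λ i → Σ≤ i (λ j → f j * g (i ∸ j)) * h (n ∸ i))
    ≡⟨ Σ≤-cong n (λ i → Σ≤-*ʳ i (h (n ∸ i)) (λ j → f j * g (i ∸ j))) ⟩
  Σ≤ n (λ i → Σ≤ i (λ j → f j * g (i ∸ j) * h (n ∸ i)))
    ≡⟨ Σ≤-triangle n (λ i j → f j * g (i ∸ j) * h (n ∸ i)) ⟩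
  Σ≤ n (λ j → Σ≤ (n ∸ j) (λ k → f j * g ((j ℕ.+ k) ∸ j) * h (n ∸ (j ℕ.+ k))))
    ≡⟨ Σ≤-cong n (λ j → Σ≤-cong (n ∸ j) (λ k →
         trans (cong₂ (λ a b → f j * g a * h b) (ℕP.m+n∸m≡n j k) (sym (ℕP.∸-+-assoc n j k)))
               (*-assoc (f j) (g k) (h (n ∸ j ∸ k))))) ⟩
  Σ≤ n (λ j → Σ≤ (n ∸ j) (λ k → f j * (g k * h (n ∸ j ∸ k))))
    ≡⟨ Σ≤-cong n (λ j → sym (Σ≤-*ˡ (n ∸ j) (f j) _)) ⟩
  Σ≤ n (λ j → f j * Σ≤ (n ∸ j) (λ k → g k * h (n ∸ j ∸ k)))
    ∎
  where open ≡-Reasoning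

constS-⊛ : ∀ c f n → (constS c ⊛ f) n ≡ c * f n
constS-⊛ c f zero    = refl
constS-⊛ c f (suc n) = begin
  (constS c ⊛ f) (suc n)                            ≡⟨ Σ≤-head n (λ i → constS c i * f (suc n ∸ i)) ⟩
  c * f (suc n) + Σ≤ n (λ i → 0ℚ * f (n ∸ i))       ≡⟨ cong (λ t → c * f (suc n) + t) (Σ≤-zero n (λ i _ → *-zeroˡ (f (n ∸ i)))) ⟩
  c * f (suc n) + 0ℚ                                ≡⟨ +-identityʳ _ ⟩
  c * f (suc n)                                     ∎
  where open ≡-Reasoning

oneS≈constS : oneS ≈ constS 1ℚ
oneS≈constS zero    = refl
oneS≈constS (suc n) = refl

⊛-identityˡ : ∀ f → oneS ⊛ f ≈ f
⊛-identityˡ f n = trans (⊛-congʳ f oneS≈constS n) (trans (constS-⊛ 1ℚ f n) (*-identityˡ (f n)))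

⊛-identityʳ : ∀ f → f ⊛ oneS ≈ f
⊛-identityʳ f = ≈-trans (⊛-comm f oneS) (⊛-identityˡ f)

⊛-distribˡ : ∀ f g h → f ⊛ (g ⊕ h) ≈ f ⊛ g ⊕ f ⊛ h
⊛-distribˡ f g h n = trans (Σ≤-cong n (λ i → *-distribˡ-+ (f i) (g (n ∸ i)) (h (n ∸ i))))
                           (Σ≤-+ n (λ i → f i * g (n ∸ i)) (λ i → f i * h (n ∸ i)))

SeriesRing : CommutativeRing 0ℓ 0ℓ
SeriesRing = record
  { Carrier = Series ; _≈_ = _≈_ ; _+_ = _⊕_ ; _*_ = _⊛_ ; -_ = negS ; 0# = zeroS ; 1# = oneS
  ; isCommutativeRing = record
    { isRing = record
      { +-isAbelianGroup = record
        { isGroup = record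
          { isMonoid = record
            { isSemigroup = record
              { isMagma = record
                { isEquivalence = record { refl = ≈-refl ; sym = ≈-sym ; trans = ≈-trans }
                ; ∙-cong = ⊕-cong }
              ; assoc = λ f g h n → +-assoc (f n) (g n) (h n) }
            ; identity = (λ f n → +-identityˡ (f n)) , (λ f n → +-identityʳ (f n)) }
          ; inverse = (λ f n → +-inverseˡ (f n)) , (λ f n → +-inverseʳ (f n))
          ; ⁻¹-cong = λ e n → cong -_ (e n) }
        ; comm = λ f g n → +-comm (f n) (g n) }
      ; *-cong = ⊛-cong
      ; *-assoc = ⊛-assoc
      ; *-identity = ⊛-identityˡ , ⊛-identityʳ
      ; distrib = ⊛-distribˡ , λ f g h → ≈-trans (⊛-comm (g ⊕ h) f)
                                           (≈-trans (⊛-distribˡ f g h) (⊕-cong (⊛-comm f g) (⊛-comm f h))) }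
    ; *-comm = ⊛-comm } }

module ≈-Reasoning = SetoidReasoning (CommutativeRing.setoid SeriesRing)

constS-+ : ∀ a b → constS (a + b) ≈ constS a ⊕ constS b
constS-+ a b zero    = refl
constS-+ a b (suc n) = sym (+-identityˡ 0ℚ)

constS-* : ∀ a b → constS (a * b) ≈ constS a ⊛ constS b
constS-* a b zero    = refl
constS-* a b (suc n) = sym (trans (constS-⊛ a (constS b) (suc n)) (*-zeroʳ a))

constS-cong : ∀ {a b} → a ≡ b → constS a ≈ constS b
constS-cong refl = ≈-refl

constS-homomorphism : ℚ.+-*-rawRing -Raw-AlmostCommutative⟶ ACR.fromCommutativeRing SeriesRing
constS-homomorphism = record
  { ⟦_⟧ = constS ; +-homo = constS-+ ; *-homo = constS-* ; -‿homo = λ { a zero → refl ; a (suc n) → refl }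
  ; 0-homo = λ { zero → refl ; (suc n) → refl } ; 1-homo = λ { zero → refl ; (suc n) → refl } }

constS-≟ : ∀ a b → Maybe (constS a ≈ constS b)
constS-≟ a b with a ≟ b
... | yes refl = just ≈-refl
... | no _     = nothing

open Algebra.Solver.Ring ℚ.+-*-rawRing (ACR.fromCommutativeRing SeriesRing) constS-homomorphism constS-≟
  using (solve; _:=_; _:+_; _:*_; :-_; _:-_; con)

-- Differentiation

derivS : Series → Series
derivS f n = fromℕ (suc n) * f (suc n)

mulX : Series → Series
mulX f zero    = 0ℚ
mulX f (suc n) = f n

mulX-cong : ∀ {f g} → f ≈ g → mulX f ≈ mulX g
mulX-cong e zero    = refl
mulX-cong e (suc n) = e n

mulX-shiftS : ∀ f → f 0 ≡ 0ℚ → f ≈ mulX (shiftS f)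
mulX-shiftS f f0 zero    = f0
mulX-shiftS f f0 (suc n) = refl

mulX-⊛ : ∀ f g → mulX f ⊛ g ≈ mulX (f ⊛ g)
mulX-⊛ f g zero    = *-zeroˡ (g 0)
mulX-⊛ f g (suc n) = trans (Σ≤-head n (λ i → mulX f i * g (suc n ∸ i)))
                           (trans (cong (_+ (f ⊛ g) n) (*-zeroˡ (g (suc n)))) (+-identityˡ _))

derivS-cong : ∀ {f g} → f ≈ g → derivS f ≈ derivS g
derivS-cong e n = cong (fromℕ (suc n) *_) (e (suc n))

derivS-⊕ : ∀ f g → derivS (f ⊕ g) ≈ derivS f ⊕ derivS g
derivS-⊕ f g n = *-distribˡ-+ (fromℕ (suc n)) (f (suc n)) (g (suc n))

derivS-constS : ∀ c → derivS (constS c) ≈ constS 0ℚ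
derivS-constS c zero    = *-zeroʳ 1ℚ
derivS-constS c (suc n) = *-zeroʳ (fromℕ (suc (suc n)))

derivS-⊛ : ∀ f g → derivS (f ⊛ g) ≈ derivS f ⊛ g ⊕ f ⊛ derivS g
derivS-⊛ f g n = begin
  fromℕ (suc n) * Σ≤ (suc n) term
    ≡⟨ Σ≤-*ˡ (suc n) (fromℕ (suc n)) term ⟩
  Σ≤ (suc n) (λ i → fromℕ (suc n) * term i)
    ≡⟨ Σ≤-cong-≤ (suc n) (λ i i≤1+n → trans (cong (_* term i) (split i≤1+n)) (*-distribʳ-+ (term i) (fromℕ i) _)) ⟩
  Σ≤ (suc n) (λ i → fromℕ i * term i + fromℕ (suc n ∸ i) * term i)
    ≡⟨ Σ≤-+ (suc n) (λ i → fromℕ i * term i) (λ i → fromℕ (suc n ∸ i) * term i) ⟩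
  Σ≤ (suc n) (λ i → fromℕ i * term i) + Σ≤ (suc n) (λ i → fromℕ (suc n ∸ i) * term i)
    ≡⟨ cong₂ _+_ left right ⟩
  (derivS f ⊛ g) n + (f ⊛ derivS g) n
    ∎
  where
  open ≡-Reasoning
  term : ℕ → ℚ
  term i = f i * g (suc n ∸ i)
  split : ∀ {i} → i ≤ suc n → fromℕ (suc n) ≡ fromℕ i + fromℕ (suc n ∸ i)
  split {i} i≤1+n = trans (cong fromℕ (sym (ℕP.m+[n∸m]≡n i≤1+n))) (fromℕ-+ i (suc n ∸ i))
  left : Σ≤ (suc n) (λ i → fromℕ i * term i) ≡ (derivS f ⊛ g) n
  left = trans (Σ≤-head n (λ i → fromℕ i * term i))
    (trans (cong (_+ Σ≤ n (λ i → fromℕ (suc i) * term (suc i))) (*-zeroˡ (term 0)))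
    (trans (+-identityˡ _) (Σ≤-cong n (λ i → sym (*-assoc (fromℕ (suc i)) (f (suc i)) (g (n ∸ i)))))))
  right : Σ≤ (suc n) (λ i → fromℕ (suc n ∸ i) * term i) ≡ (f ⊛ derivS g) n
  right = begin
    Σ≤ n (λ i → fromℕ (suc n ∸ i) * term i) + fromℕ (n ∸ n) * term (suc n)
      ≡⟨ cong (λ t → Σ≤ n (λ i → fromℕ (suc n ∸ i) * term i) + fromℕ t * term (suc n)) (ℕP.n∸n≡0 n) ⟩
    Σ≤ n (λ i → fromℕ (suc n ∸ i) * term i) + 0ℚ * term (suc n)
      ≡⟨ cong (λ t → Σ≤ n (λ i → fromℕ (suc n ∸ i) * term i) + t) (*-zeroˡ (term (suc n))) ⟩
    Σ≤ n (λ i → fromℕ (suc n ∸ i) * term i) + 0ℚ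
      ≡⟨ +-identityʳ _ ⟩
    Σ≤ n (λ i → fromℕ (suc n ∸ i) * term i)
      ≡⟨ Σ≤-cong-≤ n (λ i i≤n → trans (cong (λ t → fromℕ t * (f i * g t)) (ℕP.+-∸-assoc 1 i≤n))
                                      (swap (fromℕ (suc (n ∸ i))) (f i) (g (suc (n ∸ i))))) ⟩
    (f ⊛ derivS g) n
      ∎
    where
    swap : ∀ a b c → a * (b * c) ≡ b * (a * c)
    swap = solve-∀ ℚ-ring

derivS-constS-⊛ : ∀ c f → derivS (constS c ⊛ f) ≈ constS c ⊛ derivS f
derivS-constS-⊛ c f = begin
  derivS (constS c ⊛ f)                               ≈⟨ derivS-⊛ (constS c) f ⟩
  derivS (constS c) ⊛ f ⊕ constS c ⊛ derivS f         ≈⟨ ⊕-congʳ (constS c ⊛ derivS f) (⊛-congʳ f (derivS-constS c)) ⟩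
  constS 0ℚ ⊛ f ⊕ constS c ⊛ derivS f                 ≈⟨ solve 3 (λ K F dF → con 0ℚ :* F :+ K :* dF := K :* dF) (λ _ → refl)
                                                              (constS c) f (derivS f) ⟩
  constS c ⊛ derivS f                                 ∎
  where open ≈-Reasoning

derivS-negS : ∀ f → derivS (negS f) ≈ negS (derivS f)
derivS-negS f n = sym (neg-distribʳ-* (fromℕ (suc n)) (f (suc n)))

powS-vanish : ∀ g → g 0 ≡ 0ℚ → ∀ m n → n < m → powS g m n ≡ 0ℚ
powS-vanish g g0 (suc m) n n<1+m =
  trans (⊛-congʳ (powS g m) (mulX-shiftS g g0) n) (trans (mulX-⊛ (shiftS g) (powS g m) n) (low n n<1+m))
  where
  low : ∀ n → n < suc m → mulX (shiftS g ⊛ powS g m) n ≡ 0ℚ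
  low zero    _           = refl
  low (suc n) (s≤s n<m) = Σ≤-zero n (λ i _ → trans (cong (g (suc i) *_)
    (powS-vanish g g0 m (n ∸ i) (ℕP.≤-<-trans (ℕP.m∸n≤m n i) n<m))) (*-zeroʳ (g (suc i))))

powS-cong : ∀ {g g′} → g ≈ g′ → ∀ m → powS g m ≈ powS g′ m
powS-cong e zero    = ≈-refl
powS-cong e (suc m) = ⊛-cong e (powS-cong e m)

derivS-powS : ∀ g m → derivS (powS g (suc m)) ≈ constS (fromℕ (suc m)) ⊛ (derivS g ⊛ powS g m)
derivS-powS g zero = begin
  derivS (g ⊛ oneS)                       ≈⟨ derivS-cong (⊛-identityʳ g) ⟩
  derivS g                                ≈⟨ ≈-sym (⊛-identityʳ (derivS g)) ⟩
  derivS g ⊛ oneS                         ≈⟨ ≈-sym (⊛-identityˡ (derivS g ⊛ oneS)) ⟩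
  oneS ⊛ (derivS g ⊛ oneS)                ≈⟨ ⊛-congʳ (derivS g ⊛ oneS) oneS≈constS ⟩
  constS 1ℚ ⊛ (derivS g ⊛ oneS)           ∎
  where open ≈-Reasoning
derivS-powS g (suc m) = begin
  derivS (g ⊛ P)
    ≈⟨ derivS-⊛ g P ⟩
  derivS g ⊛ P ⊕ g ⊛ derivS P
    ≈⟨ ⊕-congˡ (derivS g ⊛ P) (⊛-congˡ g (derivS-powS g m)) ⟩
  derivS g ⊛ (g ⊛ powS g m) ⊕ g ⊛ (constS (fromℕ (suc m)) ⊛ (derivS g ⊛ powS g m))
    ≈⟨ solve 4 (λ D G Q M → D :* (G :* Q) :+ G :* (M :* (D :* Q)) := (con 1ℚ :+ M) :* (D :* (G :* Q))) (λ _ → refl)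
               (derivS g) g (powS g m) (constS (fromℕ (suc m))) ⟩
  (constS 1ℚ ⊕ constS (fromℕ (suc m))) ⊛ (derivS g ⊛ P)
    ≈⟨ ⊛-congʳ (derivS g ⊛ P) (≈-trans (≈-sym (constS-+ 1ℚ (fromℕ (suc m)))) (constS-cong (sym (fromℕ-suc (suc m))))) ⟩
  constS (fromℕ (suc (suc m))) ⊛ (derivS g ⊛ P)
    ∎
  where
  open ≈-Reasoning
  P = powS g (suc m)

-- Composition and inversion

module _ (g : Series) (g0 : g 0 ≡ 0ℚ) where

  compS-extend : ∀ a n N → n ≤ N → compS a g n ≡ Σ≤ N (λ m → a m * powS g m n)
  compS-extend a n N n≤N = Σ≤-extend N (λ m → a m * powS g m n) n≤N
    (λ m n<m _ → trans (cong (a m *_) (powS-vanish g g0 m n n<m)) (*-zeroʳ (a m)))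

  compS-⊛ : ∀ a h n → (compS a g ⊛ h) n ≡ Σ≤ n (λ m → a m * (powS g m ⊛ h) n)
  compS-⊛ a h n = begin
    Σ≤ n (λ j → compS a g j * h (n ∸ j))
      ≡⟨ Σ≤-cong-≤ n (λ j j≤n → cong (_* h (n ∸ j)) (compS-extend a j n j≤n)) ⟩
    Σ≤ n (λ j → Σ≤ n (λ m → a m * powS g m j) * h (n ∸ j))
      ≡⟨ Σ≤-cong n (λ j → Σ≤-*ʳ n (h (n ∸ j)) (λ m → a m * powS g m j)) ⟩
    Σ≤ n (λ j → Σ≤ n (λ m → a m * powS g m j * h (n ∸ j)))
      ≡⟨ Σ≤-comm n n (λ j m → a m * powS g m j * h (n ∸ j)) ⟩
    Σ≤ n (λ m → Σ≤ n (λ j → a m * powS g m j * h (n ∸ j)))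
      ≡⟨ Σ≤-cong n (λ m → trans (Σ≤-cong n (λ j → *-assoc (a m) (powS g m j) (h (n ∸ j))))
                                (sym (Σ≤-*ˡ n (a m) (λ j → powS g m j * h (n ∸ j))))) ⟩
    Σ≤ n (λ m → a m * (powS g m ⊛ h) n)
      ∎
    where open ≡-Reasoning

  compS-mulX : ∀ a → compS (mulX a) g ≈ compS a g ⊛ g
  compS-mulX a zero    = trans (*-zeroˡ 1ℚ) (sym (trans (cong (compS a g 0 *_) g0) (*-zeroʳ (compS a g 0))))
  compS-mulX a (suc n) = begin
    Σ≤ (suc n) (λ m → mulX a m * powS g m (suc n))
      ≡⟨ Σ≤-head n (λ m → mulX a m * powS g m (suc n)) ⟩
    0ℚ * 0ℚ + Σ≤ n (λ m → a m * powS g (suc m) (suc n))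
      ≡⟨ trans (+-identityˡ rest) (sym (+-identityʳ rest)) ⟩
    Σ≤ n (λ m → a m * powS g (suc m) (suc n)) + 0ℚ
      ≡⟨ cong₂ _+_ (Σ≤-cong n (λ m → cong (a m *_) (⊛-comm g (powS g m) (suc n)))) (sym top) ⟩
    Σ≤ (suc n) (λ m → a m * (powS g m ⊛ g) (suc n))
      ≡⟨ sym (compS-⊛ a g (suc n)) ⟩
    (compS a g ⊛ g) (suc n)
      ∎
    where
    open ≡-Reasoning
    rest = Σ≤ n (λ m → a m * powS g (suc m) (suc n))
    top : a (suc n) * (powS g (suc n) ⊛ g) (suc n) ≡ 0ℚ
    top = trans (cong (a (suc n) *_) (trans (⊛-comm (powS g (suc n)) g (suc n))
                                            (powS-vanish g g0 (suc (suc n)) (suc n) ℕP.≤-refl)))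
                (*-zeroʳ (a (suc n)))

  compS-⊕ : ∀ a b → compS (a ⊕ b) g ≈ compS a g ⊕ compS b g
  compS-⊕ a b n = trans (Σ≤-cong n (λ m → *-distribʳ-+ (powS g m n) (a m) (b m))) (Σ≤-+ n _ _)

  compS-constS : ∀ c → compS (constS c) g ≈ constS c
  compS-constS c zero    = *-identityʳ c
  compS-constS c (suc n) = trans (Σ≤-head n (λ m → constS c m * powS g m (suc n)))
    (trans (cong₂ _+_ (*-zeroʳ c) (Σ≤-zero n (λ m _ → *-zeroˡ (powS g (suc m) (suc n))))) (+-identityˡ 0ℚ))

  compS-cong : ∀ {a b} → a ≈ b → compS a g ≈ compS b g
  compS-cong e n = Σ≤-cong n (λ m → cong (_* powS g m n) (e m))

  chain-rule : ∀ a → derivS (compS a g) ≈ compS (derivS a) g ⊛ derivS g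
  chain-rule a n = begin
    fromℕ (suc n) * Σ≤ (suc n) (λ m → a m * powS g m (suc n))
      ≡⟨ Σ≤-*ˡ (suc n) (fromℕ (suc n)) _ ⟩
    Σ≤ (suc n) (λ m → fromℕ (suc n) * (a m * powS g m (suc n)))
      ≡⟨ Σ≤-cong (suc n) (λ m → swap (fromℕ (suc n)) (a m) (powS g m (suc n))) ⟩
    Σ≤ (suc n) (λ m → a m * derivS (powS g m) n)
      ≡⟨ Σ≤-head n (λ m → a m * derivS (powS g m) n) ⟩
    a 0 * (fromℕ (suc n) * 0ℚ) + Σ≤ n (λ m → a (suc m) * derivS (powS g (suc m)) n)
      ≡⟨ cong₂ _+_ (trans (cong (a 0 *_) (*-zeroʳ (fromℕ (suc n)))) (*-zeroʳ (a 0)))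
                   (Σ≤-cong n (λ m → cong (a (suc m) *_) (derivS-powS g m n))) ⟩
    0ℚ + Σ≤ n (λ m → a (suc m) * (constS (fromℕ (suc m)) ⊛ (derivS g ⊛ powS g m)) n)
      ≡⟨ trans (+-identityˡ _) (Σ≤-cong n term) ⟩
    Σ≤ n (λ m → derivS a m * (powS g m ⊛ derivS g) n)
      ≡⟨ sym (compS-⊛ (derivS a) (derivS g) n) ⟩
    (compS (derivS a) g ⊛ derivS g) n
      ∎
    where
    open ≡-Reasoning
    swap : ∀ x y z → x * (y * z) ≡ y * (x * z)
    swap = solve-∀ ℚ-ring
    reassoc : ∀ x y z → x * (y * z) ≡ y * x * z
    reassoc = solve-∀ ℚ-ring
    term : ∀ m → a (suc m) * (constS (fromℕ (suc m)) ⊛ (derivS g ⊛ powS g m)) n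
               ≡ derivS a m * (powS g m ⊛ derivS g) n
    term m = trans (cong (a (suc m) *_) (trans (constS-⊛ (fromℕ (suc m)) (derivS g ⊛ powS g m) n)
                                               (cong (fromℕ (suc m) *_) (⊛-comm (derivS g) (powS g m) n))))
                   (reassoc (a (suc m)) (fromℕ (suc m)) _)

compS-congʳ : ∀ a {g g′} → g ≈ g′ → compS a g ≈ compS a g′
compS-congʳ a e n = Σ≤-cong n (λ m → cong (a m *_) (powS-cong e m n))

invS-inverseˡ : ∀ f → f 0 ≡ 1ℚ → invS f ⊛ f ≈ oneS
invS-inverseˡ f f0 n = begin
  (invS f ⊛ f) n                                    ≡⟨ ⊛-congʳ f (compS-congʳ geomS (λ { zero → refl ; (suc n) → refl })) n ⟩
  (compS geomS h ⊛ f) n                             ≡⟨ compS-⊛ h refl geomS f n ⟩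
  Σ≤ n (λ m → 1ℚ * (powS h m ⊛ f) n)                ≡⟨ Σ≤-cong n (λ m → trans (*-identityˡ _) (step m)) ⟩
  Σ≤ n (λ m → powS h m n - powS h (suc m) n)        ≡⟨ Σ≤-telescope n (λ m → powS h m n) ⟩
  oneS n - powS h (suc n) n                         ≡⟨ cong (λ t → oneS n - t) (powS-vanish h refl (suc n) n ℕP.≤-refl) ⟩
  oneS n - 0ℚ                                       ≡⟨ +-identityʳ (oneS n) ⟩
  oneS n                                            ∎
  where
  open ≡-Reasoning
  h : Series
  h zero    = 0ℚ
  h (suc n) = - f (suc n)
  doubleNeg : ∀ x → x ≡ 0ℚ + - - x
  doubleNeg = solve-∀ ℚ-ring
  f≈1-h : f ≈ constS 1ℚ ⊕ negS h
  f≈1-h zero    = trans f0 (sym (+-identityʳ 1ℚ))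
  f≈1-h (suc n) = doubleNeg (f (suc n))
  step : ∀ m → (powS h m ⊛ f) n ≡ powS h m n - powS h (suc m) n
  step m = trans (⊛-congˡ (powS h m) f≈1-h n)
                 (solve 2 (λ P H → P :* (con 1ℚ :+ :- H) := P :+ :- (H :* P)) (λ _ → refl) (powS h m) h n)

⊛-cancelˡ : ∀ f {P Q} → f 0 ≡ 1ℚ → f ⊛ P ≈ f ⊛ Q → P ≈ Q
⊛-cancelˡ f {P} {Q} f0 e = begin
  P                       ≈⟨ ≈-sym (⊛-identityˡ P) ⟩
  oneS ⊛ P                ≈⟨ ⊛-congʳ P (≈-sym (invS-inverseˡ f f0)) ⟩
  (invS f ⊛ f) ⊛ P        ≈⟨ ⊛-assoc (invS f) f P ⟩
  invS f ⊛ (f ⊛ P)        ≈⟨ ⊛-congˡ (invS f) e ⟩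
  invS f ⊛ (f ⊛ Q)        ≈⟨ ≈-sym (⊛-assoc (invS f) f Q) ⟩
  (invS f ⊛ f) ⊛ Q        ≈⟨ ⊛-congʳ Q (invS-inverseˡ f f0) ⟩
  oneS ⊛ Q                ≈⟨ ⊛-identityˡ Q ⟩
  Q                       ∎
  where open ≈-Reasoning

-- Hyperbolic functions

odd : ℕ → Bool
odd zero    = false
odd (suc n) = not (odd n)

not-involutive : ∀ b → not (not b) ≡ b
not-involutive true  = refl
not-involutive false = refl

isOdd≡odd : ∀ n → isOdd n ≡ odd n
isOdd≡odd zero          = refl
isOdd≡odd (suc zero)    = refl
isOdd≡odd (suc (suc n)) = begin
  ((2 ℕ.+ n) % 2) ≡ᵇ 1    ≡⟨ cong (λ t → (t % 2) ≡ᵇ 1) (ℕP.+-comm 2 n) ⟩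
  ((n ℕ.+ 2) % 2) ≡ᵇ 1    ≡⟨ cong (_≡ᵇ 1) (ℕD.[m+n]%n≡m%n n 2) ⟩
  isOdd n                 ≡⟨ isOdd≡odd n ⟩
  odd n                   ≡⟨ sym (not-involutive (odd n)) ⟩
  odd (suc (suc n))       ∎
  where open ≡-Reasoning

isOdd-suc-suc : ∀ n → isOdd (suc (suc n)) ≡ isOdd n
isOdd-suc-suc n = trans (isOdd≡odd (suc (suc n))) (trans (not-involutive (odd n)) (sym (isOdd≡odd n)))

coshS : Series
coshS n = if isOdd n then 0ℚ else 1/ℕ (n !) {{ℕP._!≢0 n}}

halfExpCoeff-suc : ∀ n → fromℕ (suc n) * halfExpCoeff (suc n) ≡ ½ * halfExpCoeff n
halfExpCoeff-suc n = begin
  fromℕ (suc n) * 1/ℕ ((2 ℕ.* 2 ℕ.^ n) ℕ.* (suc n ℕ.* n !)) {{nz[2·2ⁿ·[1+n]!]}}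
    ≡⟨ cong (fromℕ (suc n) *_) (1/ℕ-* (2 ℕ.* 2 ℕ.^ n) (suc n ℕ.* n !) {{nz[2·2ⁿ]}} {{nz[[1+n]!]}}) ⟩
  fromℕ (suc n) * (1/ℕ (2 ℕ.* 2 ℕ.^ n) {{nz[2·2ⁿ]}} * 1/ℕ (suc n ℕ.* n !) {{nz[[1+n]!]}})
    ≡⟨ cong₂ (λ a b → fromℕ (suc n) * (a * b)) (1/ℕ-* 2 (2 ℕ.^ n) {{_}} {{nz[2ⁿ]}}) (1/ℕ-* (suc n) (n !) {{_}} {{nz[n!]}}) ⟩
  fromℕ (suc n) * ((½ * 1/ℕ (2 ℕ.^ n) {{nz[2ⁿ]}}) * (1/ℕ (suc n) * 1/ℕ (n !) {{nz[n!]}}))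
    ≡⟨ regroup (fromℕ (suc n)) ½ (1/ℕ (2 ℕ.^ n) {{nz[2ⁿ]}}) (1/ℕ (suc n)) (1/ℕ (n !) {{nz[n!]}}) ⟩
  ½ * (1/ℕ (2 ℕ.^ n) {{nz[2ⁿ]}} * 1/ℕ (n !) {{nz[n!]}}) * (fromℕ (suc n) * 1/ℕ (suc n))
    ≡⟨ cong₂ _*_ (cong (½ *_) (sym (1/ℕ-* (2 ℕ.^ n) (n !) {{nz[2ⁿ]}} {{nz[n!]}}))) (fromℕ*1/ℕ (suc n)) ⟩
  ½ * halfExpCoeff n * 1ℚ
    ≡⟨ *-identityʳ _ ⟩
  ½ * halfExpCoeff n
    ∎
  where
  open ≡-Reasoning
  nz[2ⁿ] = ℕP.m^n≢0 2 n
  nz[n!] = ℕP._!≢0 n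
  nz[2·2ⁿ] = ℕP.m*n≢0 2 (2 ℕ.^ n) {{_}} {{nz[2ⁿ]}}
  nz[[1+n]!] = ℕP.m*n≢0 (suc n) (n !) {{_}} {{nz[n!]}}
  nz[2·2ⁿ·[1+n]!] = ℕP.m*n≢0 (2 ℕ.* 2 ℕ.^ n) (suc n ℕ.* n !) {{nz[2·2ⁿ]}} {{nz[[1+n]!]}}
  regroup : ∀ a h p r f → a * ((h * p) * (r * f)) ≡ h * (p * f) * (a * r)
  regroup = solve-∀ ℚ-ring

invFactorial-suc : ∀ n → fromℕ (suc n) * 1/ℕ (suc n !) {{ℕP._!≢0 (suc n)}} ≡ 1/ℕ (n !) {{ℕP._!≢0 n}}
invFactorial-suc n = begin
  fromℕ (suc n) * 1/ℕ (suc n ℕ.* n !) {{ℕP._!≢0 (suc n)}}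
    ≡⟨ cong (fromℕ (suc n) *_) (1/ℕ-* (suc n) (n !) {{_}} {{ℕP._!≢0 n}}) ⟩
  fromℕ (suc n) * (1/ℕ (suc n) * 1/ℕ (n !) {{ℕP._!≢0 n}})
    ≡⟨ sym (*-assoc (fromℕ (suc n)) (1/ℕ (suc n)) _) ⟩
  fromℕ (suc n) * 1/ℕ (suc n) * 1/ℕ (n !) {{ℕP._!≢0 n}}
    ≡⟨ cong (_* 1/ℕ (n !) {{ℕP._!≢0 n}}) (fromℕ*1/ℕ (suc n)) ⟩
  1ℚ * 1/ℕ (n !) {{ℕP._!≢0 n}}
    ≡⟨ *-identityˡ _ ⟩
  1/ℕ (n !) {{ℕP._!≢0 n}}
    ∎
  where open ≡-Reasoning

derivS-sinhHalf : derivS sinhHalf ≈ constS ½ ⊛ coshHalf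
derivS-sinhHalf n = trans (coeff n) (sym (constS-⊛ ½ coshHalf n))
  where
  coeff : ∀ n → derivS sinhHalf n ≡ ½ * coshHalf n
  coeff n rewrite isOdd≡odd (suc n) | isOdd≡odd n with odd n
  ... | true  = trans (*-zeroʳ (fromℕ (suc n))) (sym (*-zeroʳ ½))
  ... | false = halfExpCoeff-suc n

derivS-coshHalf : derivS coshHalf ≈ constS ½ ⊛ sinhHalf
derivS-coshHalf n = trans (coeff n) (sym (constS-⊛ ½ sinhHalf n))
  where
  coeff : ∀ n → derivS coshHalf n ≡ ½ * sinhHalf n
  coeff n rewrite isOdd≡odd (suc n) | isOdd≡odd n with odd n
  ... | true  = halfExpCoeff-suc n
  ... | false = trans (*-zeroʳ (fromℕ (suc n))) (sym (*-zeroʳ ½))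

derivS-sinhS : derivS sinhS ≈ coshS
derivS-sinhS n rewrite isOdd≡odd (suc n) | isOdd≡odd n with odd n
... | true  = *-zeroʳ (fromℕ (suc n))
... | false = invFactorial-suc n

derivS-coshS : derivS coshS ≈ sinhS
derivS-coshS n rewrite isOdd≡odd (suc n) | isOdd≡odd n with odd n
... | true  = invFactorial-suc n
... | false = *-zeroʳ (fromℕ (suc n))

derivS-injective : ∀ {f g} → f 0 ≡ g 0 → derivS f ≈ derivS g → f ≈ g
derivS-injective f0≡g0 f′≈g′ zero    = f0≡g0
derivS-injective f0≡g0 f′≈g′ (suc n) = fromℕ-suc-cancelˡ n (f′≈g′ n)

derivS-injective₂ : ∀ {f g f̃ g̃} → f 0 ≡ f̃ 0 → g 0 ≡ g̃ 0 →
                    derivS f ≈ g → derivS g ≈ f → derivS f̃ ≈ g̃ → derivS g̃ ≈ f̃ → f ≈ f̃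
derivS-injective₂ {f} {g} {f̃} {g̃} f0 g0 df dg df̃ dg̃ n = proj₁ (both n)
  where
  both : ∀ n → f n ≡ f̃ n × g n ≡ g̃ n
  both zero    = f0 , g0
  both (suc n) = fromℕ-suc-cancelˡ n (trans (df n) (trans (proj₂ (both n)) (sym (df̃ n))))
               , fromℕ-suc-cancelˡ n (trans (dg n) (trans (proj₁ (both n)) (sym (dg̃ n))))

cosh²-sinh² : ∀ a s c → s 0 ≡ 0ℚ → c 0 ≡ 1ℚ → derivS s ≈ constS a ⊛ c → derivS c ≈ constS a ⊛ s →
              c ⊛ c ⊕ negS (s ⊛ s) ≈ oneS
cosh²-sinh² a s c s0 c0 ds dc = derivS-injective value (begin
  derivS (c ⊛ c ⊕ negS (s ⊛ s))
    ≈⟨ ≈-trans (derivS-⊕ (c ⊛ c) (negS (s ⊛ s))) (⊕-congˡ (derivS (c ⊛ c)) (derivS-negS (s ⊛ s))) ⟩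
  derivS (c ⊛ c) ⊕ negS (derivS (s ⊛ s))
    ≈⟨ ⊕-cong (derivS-⊛ c c) (λ n → cong -_ (derivS-⊛ s s n)) ⟩
  derivS c ⊛ c ⊕ c ⊛ derivS c ⊕ negS (derivS s ⊛ s ⊕ s ⊛ derivS s)
    ≈⟨ ⊕-cong (⊕-cong (⊛-congʳ c dc) (⊛-congˡ c dc)) (λ n → cong -_ (⊕-cong (⊛-congʳ s ds) (⊛-congˡ s ds) n)) ⟩
  (ac ⊛ s) ⊛ c ⊕ c ⊛ (ac ⊛ s) ⊕ negS ((ac ⊛ c) ⊛ s ⊕ s ⊛ (ac ⊛ c))
    ≈⟨ solve 3 (λ A S C → (A :* S) :* C :+ C :* (A :* S) :+ :- ((A :* C) :* S :+ S :* (A :* C)) := con 0ℚ)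
               (λ _ → refl) ac s c ⟩
  constS 0ℚ
    ≈⟨ ≈-sym (≈-trans (derivS-cong oneS≈constS) (derivS-constS 1ℚ)) ⟩
  derivS oneS
    ∎)
  where
  open ≈-Reasoning
  ac : Series
  ac = constS a
  value : c 0 * c 0 + - (s 0 * s 0) ≡ 1ℚ
  value rewrite s0 | c0 = refl

cosh²-sinh²-half : coshHalf ⊛ coshHalf ⊕ negS (sinhHalf ⊛ sinhHalf) ≈ oneS
cosh²-sinh²-half = cosh²-sinh² ½ sinhHalf coshHalf refl refl derivS-sinhHalf derivS-coshHalf

cosh²-sinh²-whole : coshS ⊛ coshS ⊕ negS (sinhS ⊛ sinhS) ≈ oneS
cosh²-sinh²-whole = cosh²-sinh² 1ℚ sinhS coshS refl refl (withOne derivS-sinhS) (withOne derivS-coshS)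
  where
  withOne : ∀ {f g} → f ≈ g → f ≈ constS 1ℚ ⊛ g
  withOne {g = g} e = ≈-trans e (≈-trans (≈-sym (⊛-identityˡ g)) (⊛-congʳ g oneS≈constS))

sinh-double : constS (fromℕ 2) ⊛ (sinhHalf ⊛ coshHalf) ≈ sinhS
sinh-double = derivS-injective₂ refl refl d₁ d₂ derivS-sinhS derivS-coshS
  where
  S C : Series
  S = sinhHalf
  C = coshHalf
  d₁ : derivS (constS (fromℕ 2) ⊛ (S ⊛ C)) ≈ C ⊛ C ⊕ S ⊛ S
  d₁ = begin
    derivS (constS (fromℕ 2) ⊛ (S ⊛ C))
      ≈⟨ ≈-trans (derivS-constS-⊛ (fromℕ 2) (S ⊛ C)) (⊛-congˡ (constS (fromℕ 2)) (derivS-⊛ S C)) ⟩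
    constS (fromℕ 2) ⊛ (derivS S ⊛ C ⊕ S ⊛ derivS C)
      ≈⟨ ⊛-congˡ (constS (fromℕ 2)) (⊕-cong (⊛-congʳ C derivS-sinhHalf) (⊛-congˡ S derivS-coshHalf)) ⟩
    constS (fromℕ 2) ⊛ ((constS ½ ⊛ C) ⊛ C ⊕ S ⊛ (constS ½ ⊛ S))
      ≈⟨ solve 2 (λ S C → con (fromℕ 2) :* ((con ½ :* C) :* C :+ S :* (con ½ :* S)) := C :* C :+ S :* S) (λ _ → refl) S C ⟩
    C ⊛ C ⊕ S ⊛ S
      ∎
    where open ≈-Reasoning
  d₂ : derivS (C ⊛ C ⊕ S ⊛ S) ≈ constS (fromℕ 2) ⊛ (S ⊛ C)
  d₂ = begin
    derivS (C ⊛ C ⊕ S ⊛ S)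
      ≈⟨ ≈-trans (derivS-⊕ (C ⊛ C) (S ⊛ S)) (⊕-cong (derivS-⊛ C C) (derivS-⊛ S S)) ⟩
    derivS C ⊛ C ⊕ C ⊛ derivS C ⊕ (derivS S ⊛ S ⊕ S ⊛ derivS S)
      ≈⟨ ⊕-cong (⊕-cong (⊛-congʳ C derivS-coshHalf) (⊛-congˡ C derivS-coshHalf))
                (⊕-cong (⊛-congʳ S derivS-sinhHalf) (⊛-congˡ S derivS-sinhHalf)) ⟩
    (constS ½ ⊛ S) ⊛ C ⊕ C ⊛ (constS ½ ⊛ S) ⊕ ((constS ½ ⊛ C) ⊛ S ⊕ S ⊛ (constS ½ ⊛ C))
      ≈⟨ solve 2 (λ S C → (con ½ :* S) :* C :+ C :* (con ½ :* S) :+ ((con ½ :* C) :* S :+ S :* (con ½ :* C))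
                          := con (fromℕ 2) :* (S :* C)) (λ _ → refl) S C ⟩
    constS (fromℕ 2) ⊛ (S ⊛ C)
      ∎
    where open ≈-Reasoning

-- The series A₋ₘ(tanh(t/2))

coshHalf-⊛-tanhHalf : coshHalf ⊛ tanhHalf ≈ sinhHalf
coshHalf-⊛-tanhHalf = begin
  C ⊛ (S ⊛ invS C)     ≈⟨ solve 3 (λ C S I → C :* (S :* I) := S :* (I :* C)) (λ _ → refl) C S (invS C) ⟩
  S ⊛ (invS C ⊛ C)     ≈⟨ ⊛-congˡ S (invS-inverseˡ C refl) ⟩
  S ⊛ oneS             ≈⟨ ⊛-identityʳ S ⟩
  S                    ∎
  where
  open ≈-Reasoning
  S C : Series
  S = sinhHalf
  C = coshHalf

tanhHalf-0 : tanhHalf 0 ≡ 0ℚ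
tanhHalf-0 = *-zeroˡ (invS coshHalf 0)

-- (tanh(t/2))′ = 1 / (2 cosh²(t/2)) and sinh t = 2 sinh(t/2) cosh(t/2).
sinhS-⊛-derivS-tanhHalf : sinhS ⊛ derivS tanhHalf ≈ tanhHalf
sinhS-⊛-derivS-tanhHalf = begin
  sinhS ⊛ T′
    ≈⟨ ⊛-congʳ T′ (≈-sym sinh-double) ⟩
  constS (fromℕ 2) ⊛ (S ⊛ C) ⊛ T′
    ≈⟨ solve 4 (λ S C T T′ → con (fromℕ 2) :* (S :* C) :* T′
                            := con (fromℕ 2) :* S :* ((con ½ :* S) :* T :+ C :* T′) :+ :- (S :* S :* T))
               (λ _ → refl) S C T T′ ⟩
  constS (fromℕ 2) ⊛ S ⊛ ((constS ½ ⊛ S) ⊛ T ⊕ C ⊛ T′) ⊕ negS (S ⊛ S ⊛ T)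
    ≈⟨ ⊕-congʳ (negS (S ⊛ S ⊛ T)) (⊛-congˡ (constS (fromℕ 2) ⊛ S) derivS-[C⊛T]) ⟩
  constS (fromℕ 2) ⊛ S ⊛ (constS ½ ⊛ C) ⊕ negS (S ⊛ S ⊛ T)
    ≈⟨ solve 3 (λ S C T → con (fromℕ 2) :* S :* (con ½ :* C) :+ :- (S :* S :* T) := S :* C :+ :- (S :* S :* T))
               (λ _ → refl) S C T ⟩
  S ⊛ C ⊕ negS (S ⊛ S ⊛ T)
    ≈⟨ ⊕-congʳ (negS (S ⊛ S ⊛ T)) (⊛-congʳ C (≈-sym coshHalf-⊛-tanhHalf)) ⟩
  (C ⊛ T) ⊛ C ⊕ negS (S ⊛ S ⊛ T)
    ≈⟨ solve 3 (λ S C T → (C :* T) :* C :+ :- (S :* S :* T) := (C :* C :+ :- (S :* S)) :* T) (λ _ → refl) S C T ⟩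
  (C ⊛ C ⊕ negS (S ⊛ S)) ⊛ T
    ≈⟨ ≈-trans (⊛-congʳ T cosh²-sinh²-half) (⊛-identityˡ T) ⟩
  T
    ∎
  where
  open ≈-Reasoning
  S C T T′ : Series
  S = sinhHalf
  C = coshHalf
  T = tanhHalf
  T′ = derivS tanhHalf
  derivS-[C⊛T] : (constS ½ ⊛ S) ⊛ T ⊕ C ⊛ T′ ≈ constS ½ ⊛ C
  derivS-[C⊛T] = begin
    (constS ½ ⊛ S) ⊛ T ⊕ C ⊛ T′   ≈⟨ ⊕-congʳ (C ⊛ T′) (⊛-congʳ T (≈-sym derivS-coshHalf)) ⟩
    derivS C ⊛ T ⊕ C ⊛ T′         ≈⟨ ≈-sym (derivS-⊛ C T) ⟩
    derivS (C ⊛ T)                ≈⟨ derivS-cong coshHalf-⊛-tanhHalf ⟩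
    derivS S                      ≈⟨ derivS-sinhHalf ⟩
    constS ½ ⊛ C                  ∎

compS-mulX-derivS-tanhHalf : ∀ a → compS (mulX (derivS a)) tanhHalf ≈ sinhS ⊛ derivS (compS a tanhHalf)
compS-mulX-derivS-tanhHalf a = begin
  compS (mulX (derivS a)) T          ≈⟨ compS-mulX T tanhHalf-0 (derivS a) ⟩
  compS (derivS a) T ⊛ T             ≈⟨ ⊛-congˡ (compS (derivS a) T) (≈-sym sinhS-⊛-derivS-tanhHalf) ⟩
  compS (derivS a) T ⊛ (sinhS ⊛ derivS T)
    ≈⟨ solve 3 (λ K s D → K :* (s :* D) := s :* (K :* D)) (λ _ → refl) (compS (derivS a) T) sinhS (derivS T) ⟩
  sinhS ⊛ (compS (derivS a) T ⊛ derivS T)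
                                     ≈⟨ ⊛-congˡ sinhS (≈-sym (chain-rule T tanhHalf-0 a)) ⟩
  sinhS ⊛ derivS (compS a T)         ∎
  where
  open ≈-Reasoning
  T : Series
  T = tanhHalf

A₋ : ℕ → Series
A₋ zero    = A (+ 0)
A₋ (suc m) = A -[1+ m ]

1+2*[j/2]≡j : ∀ j → isOdd j ≡ true → suc (2 ℕ.* (j ℕ./ 2)) ≡ j
1+2*[j/2]≡j j odd-j = sym (trans (ℕD.m≡m%n+[m/n]*n j 2)
  (trans (cong (ℕ._+ (j ℕ./ 2) ℕ.* 2) j%2≡1) (cong suc (ℕP.*-comm (j ℕ./ 2) 2))))
  where
  j%2≡1 : j % 2 ≡ 1
  j%2≡1 = ℕP.≡ᵇ⇒≡ (j % 2) 1 (subst Bool.T (sym odd-j) _)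

A₋-odd : ∀ m j → isOdd j ≡ true → A₋ m j ≡ fromℕ (2 ℕ.* j ℕ.^ m)
A₋-odd zero    j odd-j rewrite odd-j = refl
A₋-odd (suc m) j odd-j rewrite odd-j = cong (λ k → fromℕ (2 ℕ.* k ℕ.^ suc m)) (1+2*[j/2]≡j j odd-j)

A₋-even : ∀ m j → isOdd j ≡ false → A₋ m j ≡ 0ℚ
A₋-even zero    j even-j rewrite even-j = refl
A₋-even (suc m) j even-j rewrite even-j = refl

A₋-suc : ∀ m → A₋ (suc m) ≈ mulX (derivS (A₋ m))
A₋-suc m zero    = refl
A₋-suc m (suc n) = byParity (isOdd (suc n)) refl
  where
  byParity : ∀ b → isOdd (suc n) ≡ b → A₋ (suc m) (suc n) ≡ fromℕ (suc n) * A₋ m (suc n)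
  byParity false even = trans (A₋-even (suc m) (suc n) even)
    (sym (trans (cong (fromℕ (suc n) *_) (A₋-even m (suc n) even)) (*-zeroʳ (fromℕ (suc n)))))
  byParity true odd = begin
    A₋ (suc m) (suc n)                          ≡⟨ A₋-odd (suc m) (suc n) odd ⟩
    fromℕ (2 ℕ.* (suc n ℕ.* suc n ℕ.^ m))       ≡⟨ cong fromℕ (x∙yz≈y∙xz 2 (suc n) (suc n ℕ.^ m)) ⟩
    fromℕ (suc n ℕ.* (2 ℕ.* suc n ℕ.^ m))       ≡⟨ fromℕ-* (suc n) (2 ℕ.* suc n ℕ.^ m) ⟩
    fromℕ (suc n) * fromℕ (2 ℕ.* suc n ℕ.^ m)   ≡⟨ cong (fromℕ (suc n) *_) (sym (A₋-odd m (suc n) odd)) ⟩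
    fromℕ (suc n) * A₋ m (suc n)                ∎
    where
    open ≡-Reasoning
    open import Algebra.Properties.CommutativeSemigroup ℕP.*-commutativeSemigroup using (x∙yz≈y∙xz)

-- A₀(z) = 2z / (1 − z²)
A₋-zero : A₋ 0 ≈ mulX (mulX (A₋ 0)) ⊕ mulX (constS (fromℕ 2))
A₋-zero zero          = refl
A₋-zero (suc zero)    = refl
A₋-zero (suc (suc k)) = trans (byParity (isOdd k) refl) (sym (+-identityʳ (A₋ 0 k)))
  where
  byParity : ∀ b → isOdd k ≡ b → A₋ 0 (suc (suc k)) ≡ A₋ 0 k
  byParity false even = trans (A₋-even 0 (suc (suc k)) (trans (isOdd-suc-suc k) even)) (sym (A₋-even 0 k even))
  byParity true  odd  = trans (A₋-odd 0 (suc (suc k)) (trans (isOdd-suc-suc k) odd)) (sym (A₋-odd 0 k odd))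

G : ℕ → Series
G m = compS (A₋ m) tanhHalf

G-zero-fixed : G 0 ≈ G 0 ⊛ tanhHalf ⊛ tanhHalf ⊕ constS (fromℕ 2) ⊛ tanhHalf
G-zero-fixed = begin
  G 0
    ≈⟨ compS-cong T tanhHalf-0 A₋-zero ⟩
  compS (mulX (mulX (A₋ 0)) ⊕ mulX (constS (fromℕ 2))) T
    ≈⟨ compS-⊕ T tanhHalf-0 (mulX (mulX (A₋ 0))) (mulX (constS (fromℕ 2))) ⟩
  compS (mulX (mulX (A₋ 0))) T ⊕ compS (mulX (constS (fromℕ 2))) T
    ≈⟨ ⊕-cong (≈-trans (compS-mulX T tanhHalf-0 (mulX (A₋ 0))) (⊛-congʳ T (compS-mulX T tanhHalf-0 (A₋ 0))))
              (≈-trans (compS-mulX T tanhHalf-0 (constS (fromℕ 2))) (⊛-congʳ T (compS-constS T tanhHalf-0 (fromℕ 2)))) ⟩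
  G 0 ⊛ T ⊛ T ⊕ constS (fromℕ 2) ⊛ T
    ∎
  where
  open ≈-Reasoning
  T : Series
  T = tanhHalf

G-zero : G 0 ≈ sinhS
G-zero = begin
  G₀
    ≈⟨ ≈-sym (≈-trans (⊛-congʳ G₀ cosh²-sinh²-half) (⊛-identityˡ G₀)) ⟩
  (C ⊛ C ⊕ negS (S ⊛ S)) ⊛ G₀
    ≈⟨ solve 3 (λ C S G → (C :* C :+ :- (S :* S)) :* G := C :* C :* G :+ :- (S :* S :* G)) (λ _ → refl) C S G₀ ⟩
  C ⊛ C ⊛ G₀ ⊕ negS (S ⊛ S ⊛ G₀)
    ≈⟨ ⊕-congʳ (negS (S ⊛ S ⊛ G₀)) (⊛-congˡ (C ⊛ C) G-zero-fixed) ⟩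
  C ⊛ C ⊛ (G₀ ⊛ T ⊛ T ⊕ constS (fromℕ 2) ⊛ T) ⊕ negS (S ⊛ S ⊛ G₀)
    ≈⟨ solve 4 (λ C S G T → C :* C :* (G :* T :* T :+ con (fromℕ 2) :* T) :+ :- (S :* S :* G)
                           := (C :* T) :* (C :* T) :* G :+ con (fromℕ 2) :* ((C :* T) :* C) :+ :- (S :* S :* G))
               (λ _ → refl) C S G₀ T ⟩
  (C ⊛ T) ⊛ (C ⊛ T) ⊛ G₀ ⊕ constS (fromℕ 2) ⊛ ((C ⊛ T) ⊛ C) ⊕ negS (S ⊛ S ⊛ G₀)
    ≈⟨ ⊕-congʳ (negS (S ⊛ S ⊛ G₀)) (⊕-cong (⊛-congʳ G₀ (⊛-cong coshHalf-⊛-tanhHalf coshHalf-⊛-tanhHalf))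
                                            (⊛-congˡ (constS (fromℕ 2)) (⊛-congʳ C coshHalf-⊛-tanhHalf))) ⟩
  S ⊛ S ⊛ G₀ ⊕ constS (fromℕ 2) ⊛ (S ⊛ C) ⊕ negS (S ⊛ S ⊛ G₀)
    ≈⟨ solve 3 (λ C S G → S :* S :* G :+ con (fromℕ 2) :* (S :* C) :+ :- (S :* S :* G) := con (fromℕ 2) :* (S :* C))
               (λ _ → refl) C S G₀ ⟩
  constS (fromℕ 2) ⊛ (S ⊛ C)
    ≈⟨ sinh-double ⟩
  sinhS
    ∎
  where
  open ≈-Reasoning
  S C T G₀ : Series
  S = sinhHalf
  C = coshHalf
  T = tanhHalf
  G₀ = G 0

G-suc : ∀ m → G (suc m) ≈ sinhS ⊛ derivS (G m)
G-suc m = ≈-trans (compS-cong tanhHalf tanhHalf-0 (A₋-suc m)) (compS-mulX-derivS-tanhHalf (A₋ m))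

-- The recursion for the poly-cosecant series

-- F 0 is 1 = A₀(tanh(t/2)) / sinh t (by G-zero), not cosecSeries (+ 0).
F : ℕ → Series
F zero    = oneS
F (suc m) = cosecSeries -[1+ m ]

sinhS-⊛-F : ∀ m → sinhS ⊛ F m ≈ G m
sinhS-⊛-F zero    = ≈-trans (⊛-identityʳ sinhS) (≈-sym G-zero)
sinhS-⊛-F (suc m) = begin
  sinhS ⊛ (shiftS G′ ⊛ invS s)         ≈⟨ ⊛-congʳ (shiftS G′ ⊛ invS s) (mulX-shiftS sinhS refl) ⟩
  mulX s ⊛ (shiftS G′ ⊛ invS s)        ≈⟨ mulX-⊛ s (shiftS G′ ⊛ invS s) ⟩
  mulX (s ⊛ (shiftS G′ ⊛ invS s))      ≈⟨ mulX-cong (solve 3 (λ s g i → s :* (g :* i) := g :* (i :* s)) (λ _ → refl)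
                                                          s (shiftS G′) (invS s)) ⟩
  mulX (shiftS G′ ⊛ (invS s ⊛ s))      ≈⟨ mulX-cong (⊛-congˡ (shiftS G′) (invS-inverseˡ s refl)) ⟩
  mulX (shiftS G′ ⊛ oneS)              ≈⟨ mulX-cong (⊛-identityʳ (shiftS G′)) ⟩
  mulX (shiftS G′)                     ≈⟨ ≈-sym (mulX-shiftS G′ (*-zeroˡ 1ℚ)) ⟩
  G′                                   ∎
  where
  open ≈-Reasoning
  s G′ : Series
  s = shiftS sinhS
  G′ = G (suc m)

sinhS-cancelˡ : ∀ {P Q} → sinhS ⊛ P ≈ sinhS ⊛ Q → P ≈ Q
sinhS-cancelˡ {P} {Q} e = ⊛-cancelˡ s refl (λ n → begin
  (s ⊛ P) n                  ≡⟨ sym (mulX-⊛ s P (suc n)) ⟩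
  (mulX s ⊛ P) (suc n)       ≡⟨ ⊛-congʳ P (≈-sym (mulX-shiftS sinhS refl)) (suc n) ⟩
  (sinhS ⊛ P) (suc n)        ≡⟨ e (suc n) ⟩
  (sinhS ⊛ Q) (suc n)        ≡⟨ ⊛-congʳ Q (mulX-shiftS sinhS refl) (suc n) ⟩
  (mulX s ⊛ Q) (suc n)       ≡⟨ mulX-⊛ s Q (suc n) ⟩
  (s ⊛ Q) n                  ∎)
  where
  open ≡-Reasoning
  s : Series
  s = shiftS sinhS

Φ : Series → Series
Φ f = coshS ⊛ f ⊕ sinhS ⊛ derivS f

F-suc : ∀ m → F (suc m) ≈ Φ (F m)
F-suc m = sinhS-cancelˡ (begin
  sinhS ⊛ F (suc m)                                    ≈⟨ sinhS-⊛-F (suc m) ⟩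
  G (suc m)                                            ≈⟨ G-suc m ⟩
  sinhS ⊛ derivS (G m)                                 ≈⟨ ⊛-congˡ sinhS (derivS-cong (≈-sym (sinhS-⊛-F m))) ⟩
  sinhS ⊛ derivS (sinhS ⊛ F m)                         ≈⟨ ⊛-congˡ sinhS (derivS-⊛ sinhS (F m)) ⟩
  sinhS ⊛ (derivS sinhS ⊛ F m ⊕ sinhS ⊛ derivS (F m))  ≈⟨ ⊛-congˡ sinhS (⊕-congʳ (sinhS ⊛ derivS (F m))
                                                                                  (⊛-congʳ (F m) derivS-sinhS)) ⟩
  sinhS ⊛ Φ (F m)                                      ∎)
  where open ≈-Reasoning

Φ-cong : ∀ {f g} → f ≈ g → Φ f ≈ Φ g
Φ-cong e = ⊕-cong (⊛-congˡ coshS e) (⊛-congˡ sinhS (derivS-cong e))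

Φ-⊕ : ∀ f g → Φ (f ⊕ g) ≈ Φ f ⊕ Φ g
Φ-⊕ f g = begin
  coshS ⊛ (f ⊕ g) ⊕ sinhS ⊛ derivS (f ⊕ g)        ≈⟨ ⊕-congˡ (coshS ⊛ (f ⊕ g)) (⊛-congˡ sinhS (derivS-⊕ f g)) ⟩
  coshS ⊛ (f ⊕ g) ⊕ sinhS ⊛ (derivS f ⊕ derivS g) ≈⟨ solve 6 (λ c s f g df dg → c :* (f :+ g) :+ s :* (df :+ dg)
                                                                            := (c :* f :+ s :* df) :+ (c :* g :+ s :* dg))
                                                              (λ _ → refl) coshS sinhS f g (derivS f) (derivS g) ⟩
  Φ f ⊕ Φ g                                       ∎
  where open ≈-Reasoning

Φ-constS-⊛ : ∀ c f → Φ (constS c ⊛ f) ≈ constS c ⊛ Φ f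
Φ-constS-⊛ c f = begin
  coshS ⊛ (constS c ⊛ f) ⊕ sinhS ⊛ derivS (constS c ⊛ f)
    ≈⟨ ⊕-congˡ (coshS ⊛ (constS c ⊛ f)) (⊛-congˡ sinhS (derivS-constS-⊛ c f)) ⟩
  coshS ⊛ (constS c ⊛ f) ⊕ sinhS ⊛ (constS c ⊛ derivS f)
    ≈⟨ solve 5 (λ ch sh K f df → ch :* (K :* f) :+ sh :* (K :* df) := K :* (ch :* f :+ sh :* df))
               (λ _ → refl) coshS sinhS (constS c) f (derivS f) ⟩
  constS c ⊛ Φ f
    ∎
  where open ≈-Reasoning

-- Action of Φ and of the second derivative on cosh t sinhʲ t

sinhPow : ℕ → Series
sinhPow j = powS sinhS j

coshSinhPow : ℕ → Series
coshSinhPow j = coshS ⊛ sinhPow j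

natS : ℕ → Series
natS j = constS (fromℕ j)

natS-suc : ∀ j → natS (suc j) ≈ constS 1ℚ ⊕ natS j
natS-suc j = ≈-trans (constS-cong (fromℕ-suc j)) (constS-+ 1ℚ (fromℕ j))

cosh² : coshS ⊛ coshS ≈ constS 1ℚ ⊕ sinhS ⊛ sinhS
cosh² = begin
  coshS ⊛ coshS                                        ≈⟨ solve 2 (λ c s → c :* c := (c :* c :+ :- (s :* s)) :+ s :* s)
                                                                  (λ _ → refl) coshS sinhS ⟩
  (coshS ⊛ coshS ⊕ negS (sinhS ⊛ sinhS)) ⊕ sinhS ⊛ sinhS
                                                       ≈⟨ ⊕-congʳ (sinhS ⊛ sinhS) (≈-trans cosh²-sinh²-whole oneS≈constS) ⟩
  constS 1ℚ ⊕ sinhS ⊛ sinhS                            ∎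
  where open ≈-Reasoning

derivS-oneS : derivS oneS ≈ constS 0ℚ
derivS-oneS = ≈-trans (derivS-cong oneS≈constS) (derivS-constS 1ℚ)

derivS-sinhPow : ∀ j → derivS (sinhPow (suc j)) ≈ natS (suc j) ⊛ coshSinhPow j
derivS-sinhPow j = ≈-trans (derivS-powS sinhS j) (⊛-congˡ (natS (suc j)) (⊛-congʳ (sinhPow j) derivS-sinhS))

derivS-coshSinhPow-zero : derivS (coshSinhPow 0) ≈ sinhPow 1
derivS-coshSinhPow-zero = ≈-trans (derivS-cong (⊛-identityʳ coshS)) (≈-trans derivS-coshS (≈-sym (⊛-identityʳ sinhS)))

derivS-coshSinhPow : ∀ j → derivS (coshSinhPow (suc j)) ≈ natS (suc j) ⊛ sinhPow j ⊕ natS (suc (suc j)) ⊛ sinhPow (suc (suc j))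
derivS-coshSinhPow j = begin
  derivS (coshS ⊛ (sinhS ⊛ P))
    ≈⟨ derivS-⊛ coshS (sinhS ⊛ P) ⟩
  derivS coshS ⊛ (sinhS ⊛ P) ⊕ coshS ⊛ derivS (sinhPow (suc j))
    ≈⟨ ⊕-cong (⊛-congʳ (sinhS ⊛ P) derivS-coshS) (⊛-congˡ coshS (derivS-sinhPow j)) ⟩
  sinhS ⊛ (sinhS ⊛ P) ⊕ coshS ⊛ (X ⊛ (coshS ⊛ P))
    ≈⟨ solve 4 (λ s c P X → s :* (s :* P) :+ c :* (X :* (c :* P)) := s :* (s :* P) :+ X :* (c :* c) :* P)
               (λ _ → refl) sinhS coshS P X ⟩
  sinhS ⊛ (sinhS ⊛ P) ⊕ X ⊛ (coshS ⊛ coshS) ⊛ P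
    ≈⟨ ⊕-congˡ (sinhS ⊛ (sinhS ⊛ P)) (⊛-congʳ P (⊛-congˡ X cosh²)) ⟩
  sinhS ⊛ (sinhS ⊛ P) ⊕ X ⊛ (constS 1ℚ ⊕ sinhS ⊛ sinhS) ⊛ P
    ≈⟨ solve 3 (λ s P X → s :* (s :* P) :+ X :* (con 1ℚ :+ s :* s) :* P := X :* P :+ (con 1ℚ :+ X) :* (s :* (s :* P)))
               (λ _ → refl) sinhS P X ⟩
  X ⊛ P ⊕ (constS 1ℚ ⊕ X) ⊛ (sinhS ⊛ (sinhS ⊛ P))
    ≈⟨ ⊕-congˡ (X ⊛ P) (⊛-congʳ (sinhS ⊛ (sinhS ⊛ P)) (≈-sym (natS-suc (suc j)))) ⟩
  X ⊛ P ⊕ natS (suc (suc j)) ⊛ sinhPow (suc (suc j))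
    ∎
  where
  open ≈-Reasoning
  P X : Series
  P = sinhPow j
  X = natS (suc j)

Φ-sinhPow : ∀ j → Φ (sinhPow j) ≈ natS (suc j) ⊛ coshSinhPow j
Φ-sinhPow zero = begin
  coshS ⊛ oneS ⊕ sinhS ⊛ derivS oneS   ≈⟨ ⊕-congˡ (coshS ⊛ oneS) (⊛-congˡ sinhS derivS-oneS) ⟩
  coshS ⊛ oneS ⊕ sinhS ⊛ constS 0ℚ     ≈⟨ solve 3 (λ c s O → c :* O :+ s :* con 0ℚ := con 1ℚ :* (c :* O))
                                                   (λ _ → refl) coshS sinhS oneS ⟩
  constS 1ℚ ⊛ (coshS ⊛ oneS)           ∎
  where open ≈-Reasoning
Φ-sinhPow (suc j) = begin
  coshS ⊛ (sinhS ⊛ P) ⊕ sinhS ⊛ derivS (sinhPow (suc j))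
    ≈⟨ ⊕-congˡ (coshS ⊛ (sinhS ⊛ P)) (⊛-congˡ sinhS (derivS-sinhPow j)) ⟩
  coshS ⊛ (sinhS ⊛ P) ⊕ sinhS ⊛ (X ⊛ (coshS ⊛ P))
    ≈⟨ solve 4 (λ c s P X → c :* (s :* P) :+ s :* (X :* (c :* P)) := (con 1ℚ :+ X) :* (c :* (s :* P)))
               (λ _ → refl) coshS sinhS P X ⟩
  (constS 1ℚ ⊕ X) ⊛ (coshS ⊛ (sinhS ⊛ P))
    ≈⟨ ⊛-congʳ (coshS ⊛ (sinhS ⊛ P)) (≈-sym (natS-suc (suc j))) ⟩
  natS (suc (suc j)) ⊛ coshSinhPow (suc j)
    ∎
  where
  open ≈-Reasoning
  P X : Series
  P = sinhPow j
  X = natS (suc j)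

Φ-coshSinhPow : ∀ j → Φ (coshSinhPow j) ≈ natS (suc j) ⊛ sinhPow j ⊕ natS (suc (suc j)) ⊛ sinhPow (suc (suc j))
Φ-coshSinhPow zero = begin
  coshS ⊛ (coshS ⊛ oneS) ⊕ sinhS ⊛ derivS (coshSinhPow 0)
    ≈⟨ ⊕-congˡ (coshS ⊛ (coshS ⊛ oneS)) (⊛-congˡ sinhS derivS-coshSinhPow-zero) ⟩
  coshS ⊛ (coshS ⊛ oneS) ⊕ sinhS ⊛ (sinhS ⊛ oneS)
    ≈⟨ ⊕-congʳ (sinhS ⊛ (sinhS ⊛ oneS)) (≈-trans (≈-sym (⊛-assoc coshS coshS oneS)) (⊛-congʳ oneS cosh²)) ⟩
  (constS 1ℚ ⊕ sinhS ⊛ sinhS) ⊛ oneS ⊕ sinhS ⊛ (sinhS ⊛ oneS)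
    ≈⟨ solve 2 (λ s O → (con 1ℚ :+ s :* s) :* O :+ s :* (s :* O) := con 1ℚ :* O :+ con (fromℕ 2) :* (s :* (s :* O)))
               (λ _ → refl) sinhS oneS ⟩
  natS 1 ⊛ sinhPow 0 ⊕ natS 2 ⊛ sinhPow 2
    ∎
  where open ≈-Reasoning
Φ-coshSinhPow (suc j) = begin
  coshS ⊛ (coshS ⊛ (sinhS ⊛ P)) ⊕ sinhS ⊛ derivS (coshSinhPow (suc j))
    ≈⟨ ⊕-congˡ (coshS ⊛ (coshS ⊛ (sinhS ⊛ P))) (⊛-congˡ sinhS (derivS-coshSinhPow j)) ⟩
  coshS ⊛ (coshS ⊛ (sinhS ⊛ P)) ⊕ sinhS ⊛ (X ⊛ P ⊕ natS (suc (suc j)) ⊛ (sinhS ⊛ (sinhS ⊛ P)))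
    ≈⟨ ⊕-cong (≈-trans (≈-sym (⊛-assoc coshS coshS (sinhS ⊛ P))) (⊛-congʳ (sinhS ⊛ P) cosh²))
              (⊛-congˡ sinhS (⊕-congˡ (X ⊛ P) (⊛-congʳ (sinhS ⊛ (sinhS ⊛ P)) (natS-suc (suc j))))) ⟩
  (constS 1ℚ ⊕ sinhS ⊛ sinhS) ⊛ (sinhS ⊛ P) ⊕ sinhS ⊛ (X ⊛ P ⊕ (constS 1ℚ ⊕ X) ⊛ (sinhS ⊛ (sinhS ⊛ P)))
    ≈⟨ solve 3 (λ s P X → (con 1ℚ :+ s :* s) :* (s :* P) :+ s :* (X :* P :+ (con 1ℚ :+ X) :* (s :* (s :* P)))
                          := (con 1ℚ :+ X) :* (s :* P) :+ (con 1ℚ :+ (con 1ℚ :+ X)) :* (s :* (s :* (s :* P))))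
               (λ _ → refl) sinhS P X ⟩
  (constS 1ℚ ⊕ X) ⊛ (sinhS ⊛ P) ⊕ (constS 1ℚ ⊕ (constS 1ℚ ⊕ X)) ⊛ (sinhS ⊛ (sinhS ⊛ (sinhS ⊛ P)))
    ≈⟨ ⊕-cong (⊛-congʳ (sinhS ⊛ P) (≈-sym (natS-suc (suc j))))
              (⊛-congʳ (sinhS ⊛ (sinhS ⊛ (sinhS ⊛ P)))
                       (≈-sym (≈-trans (natS-suc (suc (suc j))) (⊕-congˡ (constS 1ℚ) (natS-suc (suc j)))))) ⟩
  natS (suc (suc j)) ⊛ sinhPow (suc j) ⊕ natS (suc (suc (suc j))) ⊛ sinhPow (suc (suc (suc j)))
    ∎
  where
  open ≈-Reasoning
  P X : Series
  P = sinhPow j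
  X = natS (suc j)

Φ²-coshSinhPow : ∀ j → Φ (Φ (coshSinhPow j)) ≈ natS (suc j) ⊛ (natS (suc j) ⊛ coshSinhPow j)
                                              ⊕ natS (suc (suc j)) ⊛ (natS (suc (suc (suc j))) ⊛ coshSinhPow (suc (suc j)))
Φ²-coshSinhPow j = begin
  Φ (Φ (coshSinhPow j))
    ≈⟨ Φ-cong (Φ-coshSinhPow j) ⟩
  Φ (natS (suc j) ⊛ sinhPow j ⊕ natS (suc (suc j)) ⊛ sinhPow (suc (suc j)))
    ≈⟨ Φ-⊕ (natS (suc j) ⊛ sinhPow j) (natS (suc (suc j)) ⊛ sinhPow (suc (suc j))) ⟩
  Φ (natS (suc j) ⊛ sinhPow j) ⊕ Φ (natS (suc (suc j)) ⊛ sinhPow (suc (suc j)))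
    ≈⟨ ⊕-cong (≈-trans (Φ-constS-⊛ (fromℕ (suc j)) (sinhPow j)) (⊛-congˡ (natS (suc j)) (Φ-sinhPow j)))
              (≈-trans (Φ-constS-⊛ (fromℕ (suc (suc j))) (sinhPow (suc (suc j))))
                       (⊛-congˡ (natS (suc (suc j))) (Φ-sinhPow (suc (suc j))))) ⟩
  natS (suc j) ⊛ (natS (suc j) ⊛ coshSinhPow j)
    ⊕ natS (suc (suc j)) ⊛ (natS (suc (suc (suc j))) ⊛ coshSinhPow (suc (suc j)))
    ∎
  where open ≈-Reasoning

derivS²-coshSinhPow-zero : derivS (derivS (coshSinhPow 0)) ≈ coshSinhPow 0
derivS²-coshSinhPow-zero = begin
  derivS (derivS (coshSinhPow 0))   ≈⟨ derivS-cong derivS-coshSinhPow-zero ⟩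
  derivS (sinhPow 1)                ≈⟨ derivS-sinhPow 0 ⟩
  natS 1 ⊛ coshSinhPow 0            ≈⟨ ⊛-congʳ (coshSinhPow 0) (≈-sym oneS≈constS) ⟩
  oneS ⊛ coshSinhPow 0              ≈⟨ ⊛-identityˡ (coshSinhPow 0) ⟩
  coshSinhPow 0                     ∎
  where open ≈-Reasoning

derivS²-coshSinhPow : ∀ j → derivS (derivS (coshSinhPow (suc (suc j))))
                            ≈ natS (suc (suc j)) ⊛ (natS (suc j) ⊛ coshSinhPow j)
                              ⊕ natS (suc (suc (suc j))) ⊛ (natS (suc (suc (suc j))) ⊛ coshSinhPow (suc (suc j)))
derivS²-coshSinhPow j = begin
  derivS (derivS (coshSinhPow (suc (suc j))))
    ≈⟨ derivS-cong (derivS-coshSinhPow (suc j)) ⟩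
  derivS (natS (suc (suc j)) ⊛ sinhPow (suc j) ⊕ natS (suc (suc (suc j))) ⊛ sinhPow (suc (suc (suc j))))
    ≈⟨ derivS-⊕ (natS (suc (suc j)) ⊛ sinhPow (suc j)) (natS (suc (suc (suc j))) ⊛ sinhPow (suc (suc (suc j)))) ⟩
  derivS (natS (suc (suc j)) ⊛ sinhPow (suc j)) ⊕ derivS (natS (suc (suc (suc j))) ⊛ sinhPow (suc (suc (suc j))))
    ≈⟨ ⊕-cong (≈-trans (derivS-constS-⊛ (fromℕ (suc (suc j))) (sinhPow (suc j)))
                       (⊛-congˡ (natS (suc (suc j))) (derivS-sinhPow j)))
              (≈-trans (derivS-constS-⊛ (fromℕ (suc (suc (suc j)))) (sinhPow (suc (suc (suc j)))))
                       (⊛-congˡ (natS (suc (suc (suc j)))) (derivS-sinhPow (suc (suc j))))) ⟩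
  natS (suc (suc j)) ⊛ (natS (suc j) ⊛ coshSinhPow j)
    ⊕ natS (suc (suc (suc j))) ⊛ (natS (suc (suc (suc j))) ⊛ coshSinhPow (suc (suc j)))
    ∎
  where open ≈-Reasoning

Φ²-constS-⊛-coshSinhPow : ∀ c j →
  Φ (Φ (constS c ⊛ coshSinhPow j))
    ≈ constS (c * fromℕ (suc j) * fromℕ (suc j)) ⊛ coshSinhPow j
      ⊕ constS (c * fromℕ (2 ℕ.+ j) * fromℕ (3 ℕ.+ j)) ⊛ coshSinhPow (2 ℕ.+ j)
Φ²-constS-⊛-coshSinhPow c j = begin
  Φ (Φ (constS c ⊛ Q))
    ≈⟨ ≈-trans (Φ-cong (Φ-constS-⊛ c Q)) (≈-trans (Φ-constS-⊛ c (Φ Q)) (⊛-congˡ (constS c) (Φ²-coshSinhPow j))) ⟩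
  constS c ⊛ (natS (suc j) ⊛ (natS (suc j) ⊛ Q) ⊕ natS (2 ℕ.+ j) ⊛ (natS (3 ℕ.+ j) ⊛ Q′))
    ≈⟨ solve 6 (λ C X Y Z Q R → C :* (X :* (X :* Q) :+ Y :* (Z :* R)) := C :* X :* X :* Q :+ C :* Y :* Z :* R)
               (λ _ → refl) (constS c) (natS (suc j)) (natS (2 ℕ.+ j)) (natS (3 ℕ.+ j)) Q Q′ ⟩
  constS c ⊛ natS (suc j) ⊛ natS (suc j) ⊛ Q ⊕ constS c ⊛ natS (2 ℕ.+ j) ⊛ natS (3 ℕ.+ j) ⊛ Q′
    ≈⟨ ⊕-cong (⊛-congʳ Q (≈-sym (constS-*³ c (fromℕ (suc j)) (fromℕ (suc j)))))
              (⊛-congʳ Q′ (≈-sym (constS-*³ c (fromℕ (2 ℕ.+ j)) (fromℕ (3 ℕ.+ j))))) ⟩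
  constS (c * fromℕ (suc j) * fromℕ (suc j)) ⊛ Q ⊕ constS (c * fromℕ (2 ℕ.+ j) * fromℕ (3 ℕ.+ j)) ⊛ Q′
    ∎
  where
  open ≈-Reasoning
  Q Q′ : Series
  Q = coshSinhPow j
  Q′ = coshSinhPow (2 ℕ.+ j)
  constS-*³ : ∀ a b c → constS (a * b * c) ≈ constS a ⊛ constS b ⊛ constS c
  constS-*³ a b c = ≈-trans (constS-* (a * b) c) (⊛-congʳ (constS c) (constS-* a b))

constS-⊛-+ : ∀ a b Q → constS a ⊛ Q ⊕ constS b ⊛ Q ≈ constS (a + b) ⊛ Q
constS-⊛-+ a b Q = ≈-trans (solve 3 (λ A B Q → A :* Q :+ B :* Q := (A :+ B) :* Q) (λ _ → refl) (constS a) (constS b) Q)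
                           (⊛-congʳ Q (≈-sym (constS-+ a b)))

-- Expansion of the odd-index series and extraction of even coefficients

double : ℕ → ℕ
double zero    = zero
double (suc l) = suc (suc (double l))

2*≡double : ∀ k → 2 ℕ.* k ≡ double k
2*≡double zero    = refl
2*≡double (suc k) = trans (ℕP.*-suc 2 k) (cong (λ t → suc (suc t)) (2*≡double k))

-- U n l = (2n)! [t²ⁿ] cosh t sinh²ˡ t, see coshSinhPow-coeff.
U : ℕ → ℕ → ℚ
U zero    zero    = 1ℚ
U zero    (suc l) = 0ℚ
U (suc k) zero    = U k zero
U (suc k) (suc l) = fromℕ (3 ℕ.+ double l) * fromℕ (3 ℕ.+ double l) * U k (suc l)
                  + fromℕ (2 ℕ.+ double l) * fromℕ (1 ℕ.+ double l) * U k l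

U-vanish : ∀ k l → k < l → U k l ≡ 0ℚ
U-vanish zero    (suc l) _         = refl
U-vanish (suc k) (suc l) (s≤s k<l) =
  trans (cong₂ (λ x y → α * x + β * y) (U-vanish k (suc l) (ℕP.m≤n⇒m≤1+n k<l)) (U-vanish k l k<l)) (annihilate α β)
  where
  α β : ℚ
  α = fromℕ (3 ℕ.+ double l) * fromℕ (3 ℕ.+ double l)
  β = fromℕ (2 ℕ.+ double l) * fromℕ (1 ℕ.+ double l)
  annihilate : ∀ a b → a * 0ℚ + b * 0ℚ ≡ 0ℚ
  annihilate = solve-∀ ℚ-ring

ΣS : ℕ → (ℕ → Series) → Series
ΣS N h n = Σ≤ N (λ l → h l n)

ΣS-cong : ∀ N {h h′} → (∀ l → h l ≈ h′ l) → ΣS N h ≈ ΣS N h′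
ΣS-cong N e n = Σ≤-cong N (λ l → e l n)

ΣS-⊕ : ∀ N h k → ΣS N (λ l → h l ⊕ k l) ≈ ΣS N h ⊕ ΣS N k
ΣS-⊕ N h k n = Σ≤-+ N (λ l → h l n) (λ l → k l n)

Φ-ΣS : ∀ N h → Φ (ΣS N h) ≈ ΣS N (λ l → Φ (h l))
Φ-ΣS zero    h = Φ-cong {ΣS 0 h} {h 0} (λ n → refl)
Φ-ΣS (suc N) h = begin
  Φ (ΣS (suc N) h)               ≈⟨ Φ-cong {ΣS (suc N) h} {ΣS N h ⊕ h (suc N)} (λ n → refl) ⟩
  Φ (ΣS N h ⊕ h (suc N))         ≈⟨ Φ-⊕ (ΣS N h) (h (suc N)) ⟩
  Φ (ΣS N h) ⊕ Φ (h (suc N))     ≈⟨ ⊕-congʳ (Φ (h (suc N))) (Φ-ΣS N h) ⟩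
  ΣS (suc N) (λ l → Φ (h l))     ∎
  where open ≈-Reasoning

oddTerm : ℕ → ℕ → Series
oddTerm k l = constS (fromℕ (suc (double l)) * U k l) ⊛ coshSinhPow (double l)

constS-zero-⊛ : ∀ {c} f → c ≡ 0ℚ → constS c ⊛ f ≈ zeroS
constS-zero-⊛ {c} f c≡0 n = trans (constS-⊛ c f n) (trans (cong (_* f n) c≡0) (*-zeroˡ (f n)))

F-odd : ∀ k → F (suc (double k)) ≈ ΣS k (oddTerm k)
F-odd zero = ≈-trans (F-suc 0) (≈-trans (Φ-sinhPow 0) (⊛-congʳ (coshSinhPow 0) (constS-cong (sym (*-identityʳ 1ℚ)))))
F-odd (suc k) = begin
  F (suc (suc (suc (double k))))          ≈⟨ ≈-trans (F-suc (suc (suc (double k)))) (Φ-cong (F-suc (suc (double k)))) ⟩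
  Φ (Φ (F (suc (double k))))              ≈⟨ Φ-cong (Φ-cong (F-odd k)) ⟩
  Φ (Φ (ΣS k (oddTerm k)))                ≈⟨ ≈-trans (Φ-cong (Φ-ΣS k (oddTerm k))) (Φ-ΣS k (λ l → Φ (oddTerm k l))) ⟩
  ΣS k (λ l → Φ (Φ (oddTerm k l)))        ≈⟨ ΣS-cong k (λ l → Φ²-constS-⊛-coshSinhPow (e l) (double l)) ⟩
  ΣS k (λ l → same l ⊕ next l)            ≈⟨ ΣS-⊕ k same next ⟩
  ΣS k same ⊕ ΣS k next                   ≈⟨ ⊕-cong extend-same shift-next ⟩
  ΣS (suc k) same ⊕ ΣS (suc k) previous   ≈⟨ ≈-sym (ΣS-⊕ (suc k) same previous) ⟩
  ΣS (suc k) (λ l → same l ⊕ previous l)  ≈⟨ ΣS-cong (suc k) recombine ⟩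
  ΣS (suc k) (oddTerm (suc k))            ∎
  where
  open ≈-Reasoning
  e : ℕ → ℚ
  e l = fromℕ (suc (double l)) * U k l
  i : ℕ → ℚ
  i j = fromℕ j
  -- Φ² splits the l-th term into a multiple of cosh t sinh²ˡ t and one of cosh t sinh²ˡ⁺² t; shifting the
  -- latter by one index gives exactly the recursion defining U (k+1).
  same next previous : ℕ → Series
  same l = constS (e l * i (suc (double l)) * i (suc (double l))) ⊛ coshSinhPow (double l)
  next l = constS (e l * i (2 ℕ.+ double l) * i (3 ℕ.+ double l)) ⊛ coshSinhPow (2 ℕ.+ double l)
  previous zero    = constS 0ℚ ⊛ coshSinhPow 0
  previous (suc l) = next l

  extend-same : ΣS k same ≈ ΣS (suc k) same
  extend-same n = sym (trans (cong (λ t → ΣS k same n + t) (constS-zero-⊛ (coshSinhPow (double (suc k))) top n))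
                             (+-identityʳ _))
    where
    top : e (suc k) * i (suc (double (suc k))) * i (suc (double (suc k))) ≡ 0ℚ
    top = trans (cong (λ t → i (suc (double (suc k))) * t * i (suc (double (suc k))) * i (suc (double (suc k))))
                      (U-vanish k (suc k) ℕP.≤-refl))
                (annihilate (i (suc (double (suc k)))) (i (suc (double (suc k)))))
      where
      annihilate : ∀ a b → a * 0ℚ * b * b ≡ 0ℚ
      annihilate = solve-∀ ℚ-ring

  shift-next : ΣS k next ≈ ΣS (suc k) previous
  shift-next n = sym (trans (Σ≤-head k (λ l → previous l n))
                            (trans (cong (_+ ΣS k next n) (constS-zero-⊛ (coshSinhPow 0) refl n)) (+-identityˡ _)))

  recombine : ∀ l → same l ⊕ previous l ≈ oddTerm (suc k) l
  recombine zero = ≈-trans (constS-⊛-+ _ 0ℚ (coshSinhPow 0)) (⊛-congʳ (coshSinhPow 0) (constS-cong (simplify (e 0))))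
    where
    simplify : ∀ a → a * 1ℚ * 1ℚ + 0ℚ ≡ a
    simplify = solve-∀ ℚ-ring
  recombine (suc l) = ≈-trans (constS-⊛-+ _ _ (coshSinhPow (2 ℕ.+ double l)))
    (⊛-congʳ (coshSinhPow (2 ℕ.+ double l))
             (constS-cong (factor (i (1 ℕ.+ double l)) (i (2 ℕ.+ double l)) (i (3 ℕ.+ double l)) (U k (suc l)) (U k l))))
    where
    factor : ∀ i₁ i₂ i₃ a b → i₃ * a * i₃ * i₃ + i₁ * b * i₂ * i₃ ≡ i₃ * (i₃ * i₃ * a + i₂ * i₁ * b)
    factor = solve-∀ ℚ-ring

factorial-derivS² : ∀ m f → fromℕ (suc (suc m) !) * f (suc (suc m)) ≡ fromℕ (m !) * derivS (derivS f) m
factorial-derivS² m f = begin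
  fromℕ (suc (suc m) ℕ.* (suc m ℕ.* m !)) * f (suc (suc m))
    ≡⟨ cong (_* f (suc (suc m))) (trans (fromℕ-* (suc (suc m)) (suc m ℕ.* m !))
                                        (cong (fromℕ (suc (suc m)) *_) (fromℕ-* (suc m) (m !)))) ⟩
  fromℕ (suc (suc m)) * (fromℕ (suc m) * fromℕ (m !)) * f (suc (suc m))
    ≡⟨ reorder (fromℕ (suc (suc m))) (fromℕ (suc m)) (fromℕ (m !)) (f (suc (suc m))) ⟩
  fromℕ (m !) * derivS (derivS f) m
    ∎
  where
  open ≡-Reasoning
  reorder : ∀ a b c x → a * (b * c) * x ≡ c * (b * (a * x))
  reorder = solve-∀ ℚ-ring

coshSinhPow-coeff : ∀ n l → fromℕ (double n !) * coshSinhPow (double l) (double n) ≡ U n l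
coshSinhPow-coeff zero    zero    = refl
coshSinhPow-coeff zero    (suc l) = trans (cong (fromℕ 1 *_) (trans (cong (coshS 0 *_) (*-zeroˡ (sinhPow (suc (double l)) 0)))
                                                                    (*-zeroʳ (coshS 0))))
                                          (*-zeroʳ (fromℕ 1))
coshSinhPow-coeff (suc n) zero    = begin
  fromℕ (double (suc n) !) * coshSinhPow 0 (double (suc n))        ≡⟨ factorial-derivS² (double n) (coshSinhPow 0) ⟩
  fromℕ (double n !) * derivS (derivS (coshSinhPow 0)) (double n)  ≡⟨ cong (fromℕ (double n !) *_) (derivS²-coshSinhPow-zero (double n)) ⟩
  fromℕ (double n !) * coshSinhPow 0 (double n)                    ≡⟨ coshSinhPow-coeff n 0 ⟩
  U n 0                                                            ∎
  where open ≡-Reasoning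
coshSinhPow-coeff (suc n) (suc l) = begin
  fromℕ (double (suc n) !) * coshSinhPow (2 ℕ.+ j) (2 ℕ.+ m)
    ≡⟨ factorial-derivS² m (coshSinhPow (2 ℕ.+ j)) ⟩
  fromℕ (m !) * derivS (derivS (coshSinhPow (2 ℕ.+ j))) m
    ≡⟨ cong (fromℕ (m !) *_) (trans (derivS²-coshSinhPow j m) (cong₂ _+_ (scalars (2 ℕ.+ j) (1 ℕ.+ j) j)
                                                                          (scalars (3 ℕ.+ j) (3 ℕ.+ j) (2 ℕ.+ j)))) ⟩
  fromℕ (m !) * (i (2 ℕ.+ j) * (i (1 ℕ.+ j) * coshSinhPow j m) + i (3 ℕ.+ j) * (i (3 ℕ.+ j) * coshSinhPow (2 ℕ.+ j) m))
    ≡⟨ regroup (fromℕ (m !)) (i (1 ℕ.+ j)) (i (2 ℕ.+ j)) (i (3 ℕ.+ j)) (coshSinhPow j m) (coshSinhPow (2 ℕ.+ j) m) ⟩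
  i (3 ℕ.+ j) * i (3 ℕ.+ j) * (fromℕ (m !) * coshSinhPow (2 ℕ.+ j) m) + i (2 ℕ.+ j) * i (1 ℕ.+ j) * (fromℕ (m !) * coshSinhPow j m)
    ≡⟨ cong₂ (λ a b → i (3 ℕ.+ j) * i (3 ℕ.+ j) * a + i (2 ℕ.+ j) * i (1 ℕ.+ j) * b)
             (coshSinhPow-coeff n (suc l)) (coshSinhPow-coeff n l) ⟩
  U (suc n) (suc l)
    ∎
  where
  open ≡-Reasoning
  m j : ℕ
  m = double n
  j = double l
  i : ℕ → ℚ
  i = fromℕ
  scalars : ∀ a b c → (natS a ⊛ (natS b ⊛ coshSinhPow c)) m ≡ i a * (i b * coshSinhPow c m)
  scalars a b c = trans (constS-⊛ (i a) (natS b ⊛ coshSinhPow c) m) (cong (i a *_) (constS-⊛ (i b) (coshSinhPow c) m))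
  regroup : ∀ F i₁ i₂ i₃ a b → F * (i₂ * (i₁ * a) + i₃ * (i₃ * b)) ≡ i₃ * i₃ * (F * b) + i₂ * i₁ * (F * a)
  regroup = solve-∀ ℚ-ring

pairing : ℕ → ℕ → ℚ
pairing k n = Σ≤ (k ℕ.+ n) (λ l → fromℕ (suc (double l)) * (U k l * U n l))

pairing-comm : ∀ k n → pairing k n ≡ pairing n k
pairing-comm k n = trans (cong (λ t → Σ≤ t (λ l → fromℕ (suc (double l)) * (U k l * U n l))) (ℕP.+-comm k n))
                         (Σ≤-cong (n ℕ.+ k) (λ l → cong (fromℕ (suc (double l)) *_) (*-comm (U k l) (U n l))))

D-odd-even : ∀ k n → D -[1+ double k ] (double n) ≡ pairing k n
D-odd-even k n = begin
  fromℕ (m !) * F (suc (double k)) m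
    ≡⟨ cong (fromℕ (m !) *_) (F-odd k m) ⟩
  fromℕ (m !) * Σ≤ k (λ l → oddTerm k l m)
    ≡⟨ Σ≤-*ˡ k (fromℕ (m !)) (λ l → oddTerm k l m) ⟩
  Σ≤ k (λ l → fromℕ (m !) * oddTerm k l m)
    ≡⟨ Σ≤-cong k coefficient ⟩
  Σ≤ k (λ l → fromℕ (suc (double l)) * (U k l * U n l))
    ≡⟨ Σ≤-extend (k ℕ.+ n) _ (ℕP.m≤m+n k n) (λ l k<l _ →
         trans (cong (λ t → fromℕ (suc (double l)) * (t * U n l)) (U-vanish k l k<l)) (annihilate (fromℕ (suc (double l))) (U n l))) ⟩
  pairing k n
    ∎
  where
  open ≡-Reasoning
  m : ℕ
  m = double n
  coefficient : ∀ l → fromℕ (m !) * oddTerm k l m ≡ fromℕ (suc (double l)) * (U k l * U n l)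
  coefficient l = begin
    fromℕ (m !) * oddTerm k l m
      ≡⟨ cong (fromℕ (m !) *_) (constS-⊛ _ (coshSinhPow (double l)) m) ⟩
    fromℕ (m !) * (fromℕ (suc (double l)) * U k l * coshSinhPow (double l) m)
      ≡⟨ reorder (fromℕ (m !)) (fromℕ (suc (double l))) (U k l) (coshSinhPow (double l) m) ⟩
    fromℕ (suc (double l)) * (U k l * (fromℕ (m !) * coshSinhPow (double l) m))
      ≡⟨ cong (λ t → fromℕ (suc (double l)) * (U k l * t)) (coshSinhPow-coeff n l) ⟩
    fromℕ (suc (double l)) * (U k l * U n l)
      ∎
    where
    reorder : ∀ F i a x → F * (i * a * x) ≡ i * (a * (F * x))
    reorder = solve-∀ ℚ-ring
  annihilate : ∀ a b → a * (0ℚ * b) ≡ 0ℚ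
  annihilate = solve-∀ ℚ-ring

theorem3p1 : (n k : ℕ) → D -[1+ 2 ℕ.* k ] (2 ℕ.* n) ≡ D -[1+ 2 ℕ.* n ] (2 ℕ.* k)
theorem3p1 n k = begin
  D -[1+ 2 ℕ.* k ] (2 ℕ.* n)     ≡⟨ cong₂ (λ a b → D -[1+ a ] b) (2*≡double k) (2*≡double n) ⟩
  D -[1+ double k ] (double n)   ≡⟨ D-odd-even k n ⟩
  pairing k n                    ≡⟨ pairing-comm k n ⟩
  pairing n k                    ≡⟨ D-odd-even n k ⟨
  D -[1+ double n ] (double k)   ≡⟨ cong₂ (λ a b → D -[1+ a ] b) (2*≡double n) (2*≡double k) ⟨
  D -[1+ 2 ℕ.* n ] (2 ℕ.* k)     ∎
  where open ≡-Reasoning
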